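{- Let $q$ be a prime power and $r\geq 1$. Let $G$ be a regular subgroup of the general affine group $GA(r,q)$, let $T$ be an automorphism of the group $G$, and let $\tau$ be the permutation of $F_q^r$ induced by $T$. Then the code $$S_{\tau}=\bigcup_{a\in F_q^r} C_a\times D_{\tau(a)}$$ is a $q$-ary propelinear perfect code of length $\frac{q^{r+1}-1}{q-1}$.
   Context: Let $n=\frac{q^r-1}{q-1}$. Let $H_C$ be an $r\times n$ matrix over $F_q$ whose columns are representatives of the $n$ distinct one-dimensional subspaces of $F_q^r$ (a parity check matrix of the $q$-ary Hamming code $C=\{x\in F_q^n: H_Cx^T={\bf 0}\}$). For $a\in F_q^r$ let $C_a=\{x\in F_q^n: H_Cx^T=a\}$. Let $D$ be the linear code of length $q^r$ whose coordinate positions are indexed by the vectors of $F_q^r$ and whose parity check matrix $H_D$ has, in the position indexed by $a$, the column $\binom{1}{a}$; i.e. $D=\{y=(y_a)_{a\in F_q^r}: \sum_a y_a=0,\ \sum_a y_a a={\bf 0}\}$. Let $e_a$ be the vector of length $q^r$ with $1$ in position $a$ and $0$ elsewhere, and $D_a=D+e_{\bf 0}-e_a$. For sets $X\subseteq F_q^n$, $Y\subseteq F_q^{q^r}$, $X\times Y=\{(x|y):x\in X,y\in Y\}$ where $|$ denotes concatenation. The general affine group $GA(r,q)$ consists of pairs $(a,M)$ with $a\in F_q^r$, $M\in GL(r,q)$, acting on column vectors by $(a,M)(b)=a+Mb$, with composition $(a,M)(b,M')=(a+Mb,MM')$. A subgroup $G$ is regular if it acts regularly on $F_q^r$; then for each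 $a\in F_q^r$ there is a unique $g_a\in G$ with $g_a({\bf 0})=a$. The permutation $\tau$ of $F_q^r$ induced by an automorphism $T$ of $G$ is defined by $g_{\tau(a)}=T(g_a)$ for all $a$. A code $S\subseteq F_q^N$ is perfect if it is a $1$-perfect code (the Hamming balls of radius $1$ around codewords partition $F_q^N$). The automorphism group of $F_q^N$ is the group of all isometries of $F_q^N$ with respect to the Hamming metric (the automorphism group of the Hamming graph $H(N,q)$); the automorphism group of a code is its setwise stabilizer in this group; a code is propelinear if its automorphism group contains a subgroup acting regularly on the codewords. -}

module Defs where

open import Data.Nat as ℕ using (ℕ; zero; suc; _≤_; _^_; _∸_)
open import Data.Nat.Primality using (Prime)
open import Data.Fin as Fin using (Fin; zero; suc)
open import Data.Fin.Properties using (all?)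
open import Data.Product using (Σ; ∃; _×_; _,_; ∃-syntax; Σ-syntax)
open import Data.Bool using (Bool; true; false; if_then_else_)
open import Data.Vec.Functional using (Vector; _++_)
open import Function.Bundles using (_↔_)
open import Relation.Binary.PropositionalEquality using (_≡_; _≢_)
open import Relation.Nullary using (¬_; Dec; does)
open import Relation.Binary.Definitions using (DecidableEquality)
open import Algebra.Structures using (IsCommutativeRing)

IsPrimePower : ℕ → Set
IsPrimePower q = Σ[ p ∈ ℕ ] Σ[ k ∈ ℕ ] (Prime p × 1 ≤ k × q ≡ p ^ k)

record FiniteField (q : ℕ) : Set₁ where
  infixl 6 _+_
  infixl 7 _*_
  field
    Carrier           : Set
    _+_ _*_           : Carrier → Carrier → Carrier
    -_                : Carrier → Carrier
    0# 1#             : Carrier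
    isCommutativeRing : IsCommutativeRing _≡_ _+_ _*_ -_ 0# 1#
    _≟_               : DecidableEquality Carrier
    0≢1               : 0# ≢ 1#
    inverse           : ∀ x → x ≢ 0# → ∃[ y ] (x * y ≡ 1#)
    enumeration       : Carrier ↔ Fin q

module Codes {q : ℕ} (F : FiniteField q) where
  open FiniteField F

  sum : ∀ {N} → (Fin N → Carrier) → Carrier
  sum {zero}  f = 0#
  sum {suc N} f = f zero + sum (λ i → f (suc i))

  Word : ℕ → Set
  Word N = Vector Carrier N

  _≈w_ : ∀ {N} → Word N → Word N → Set
  x ≈w y = ∀ i → x i ≡ y i

  dist : ∀ {N} → Word N → Word N → ℕ
  dist {zero}  x y = 0
  dist {suc N} x y =
    (if does (x zero ≟ y zero) then 0 else 1)
      ℕ.+ dist (λ i → x (suc i)) (λ i → y (suc i))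

  Code : ℕ → Set₁
  Code N = Word N → Set

  -- 1-perfect: the radius-1 balls around codewords partition F_q^N
  IsPerfect : ∀ {N} → Code N → Set
  IsPerfect {N} S =
    (z : Word N) →
      (∃[ c ] (S c × dist z c ≤ 1)) ×
      (∀ c c' → S c → S c' → dist z c ≤ 1 → dist z c' ≤ 1 → c ≈w c')

  record Isometry (N : ℕ) : Set where
    field
      to from   : Word N → Word N
      to-from   : ∀ x → to (from x) ≈w x
      from-to   : ∀ x → from (to x) ≈w x
      isometric : ∀ x y → dist (to x) (to y) ≡ dist x y

  open Isometry public

  _≈I_ : ∀ {N} → Isometry N → Isometry N → Set
  φ ≈I ψ = ∀ x → to φ x ≈w to ψ x

  idI : ∀ {N} → Isometry N
  idI = record { to = λ x → x ; from = λ x → x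
               ; to-from = λ x i → _≡_.refl ; from-to = λ x i → _≡_.refl
               ; isometric = λ x y → _≡_.refl }

  InAut : ∀ {N} → Code N → Isometry N → Set
  InAut S φ = (∀ x → S x → S (to φ x)) × (∀ y → S y → S (from φ y))

  -- S is propelinear: some subgroup of Aut(S) acts regularly on S
  IsPropelinear : ∀ {N} → Code N → Set₁
  IsPropelinear {N} S =
    Σ[ P ∈ (Isometry N → Set) ]
      ( (∀ φ ψ → φ ≈I ψ → P φ → P ψ)
      × (∀ φ → P φ → InAut S φ)
      × P idI
      × (∀ φ ψ → P φ → P ψ → Σ[ χ ∈ Isometry N ] (P χ × (∀ x → to χ x ≈w to φ (to ψ x))))
      × (∀ φ → P φ → Σ[ χ ∈ Isometry N ] (P χ × (∀ x → to χ x ≈w from φ x)))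
      × (∀ x y → S x → S y → Σ[ φ ∈ Isometry N ] (P φ × to φ x ≈w y))
      × (∀ φ ψ x → S x → P φ → P ψ → to φ x ≈w to ψ x → φ ≈I ψ) )

  V : ℕ → Set
  V r = Fin r → Carrier

  _≈v_ : ∀ {r} → V r → V r → Set
  a ≈v b = ∀ i → a i ≡ b i

  _≟v_ : ∀ {r} (a b : V r) → Dec (a ≈v b)
  a ≟v b = all? (λ i → a i ≟ b i)

  0v : ∀ {r} → V r
  0v i = 0#

  _+v_ : ∀ {r} → V r → V r → V r
  (a +v b) i = a i + b i

  _•_ : ∀ {r} → Carrier → V r → V r
  (λ' • a) i = λ' * a i

  Matrix : ℕ → Set
  Matrix r = Fin r → Fin r → Carrier

  _≈m_ : ∀ {r} → Matrix r → Matrix r → Set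
  M ≈m M' = ∀ i j → M i j ≡ M' i j

  idM : ∀ {r} → Matrix r
  idM i j = if does (i Fin.≟ j) then 1# else 0#

  _·m_ : ∀ {r} → Matrix r → Matrix r → Matrix r
  (M ·m M') i j = sum (λ k → M i k * M' k j)

  _·v_ : ∀ {r} → Matrix r → V r → V r
  (M ·v b) i = sum (λ k → M i k * b k)

  IsGL : ∀ {r} → Matrix r → Set
  IsGL M = ∃[ M' ] ((M ·m M') ≈m idM × (M' ·m M) ≈m idM)

  -- an element (a , M) of the affine group (M invertible is imposed
  -- on the subgroups considered, see IsSubgroupGA)
  record Aff (r : ℕ) : Set where
    constructor ⟨_,_⟩
    field
      shift : V r
      lin   : Matrix r

  open Aff public

  _≈A_ : ∀ {r} → Aff r → Aff r → Set
  g ≈A h = (shift g ≈v shift h) × (lin g ≈m lin h)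

  act : ∀ {r} → Aff r → V r → V r
  act g b = shift g +v (lin g ·v b)

  _∘A_ : ∀ {r} → Aff r → Aff r → Aff r
  g ∘A h = ⟨ act g (shift h) , lin g ·m lin h ⟩

  idA : ∀ {r} → Aff r
  idA = ⟨ 0v , idM ⟩

  IsSubgroupGA : ∀ {r} → (Aff r → Set) → Set
  IsSubgroupGA G =
      (∀ g h → g ≈A h → G g → G h)
    × (∀ g → G g → IsGL (lin g))
    × G idA
    × (∀ g h → G g → G h → G (g ∘A h))
    × (∀ g → G g → ∃[ h ] (G h × (g ∘A h) ≈A idA × (h ∘A g) ≈A idA))

  IsRegular : ∀ {r} → (Aff r → Set) → Set
  IsRegular {r} G =
      (∀ (b c : V r) → ∃[ g ] (G g × act g b ≈v c))
    × (∀ g h (b : V r) → G g → G h → act g b ≈v act h b → g ≈A h)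

  IsAutomorphism : ∀ {r} → (Aff r → Set) → (Aff r → Aff r) → Set
  IsAutomorphism G T =
      (∀ g → G g → G (T g))
    × (∀ g h → G g → G h → g ≈A h → T g ≈A T h)
    × (∀ g h → G g → G h → T (g ∘A h) ≈A (T g ∘A T h))
    × (∀ g h → G g → G h → T g ≈A T h → g ≈A h)
    × (∀ h → G h → ∃[ g ] (G g × T g ≈A h))

  -- τ is the permutation induced by T:  g_{τ(a)} = T(g_a), i.e.
  -- T(g_a) is the element of G sending 0 to τ(a)
  IsInducedPerm : ∀ {r} → (Aff r → Set) → (Aff r → Aff r) → (V r → V r) → Set
  IsInducedPerm G T τ =
    ∀ a g → G g → act g 0v ≈v a → act (T g) 0v ≈v τ a

  -- columns H j of H_C are representatives of the n distinct
  -- one-dimensional subspaces of F_q^r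
  IsHammingPCM : ∀ {r n} → (Fin n → V r) → Set
  IsHammingPCM {r} H =
      (∀ j → ¬ (H j ≈v 0v))
    × (∀ j k λ' → H j ≈v (λ' • H k) → j ≡ k)
    × (∀ (v : V r) → ¬ (v ≈v 0v) → ∃[ j ] ∃[ λ' ] (v ≈v (λ' • H j)))

  syndrome : ∀ {r n} → (Fin n → V r) → Word n → V r
  syndrome H x i = sum (λ j → H j i * x j)

  Ca : ∀ {r n} → (Fin n → V r) → V r → Code n
  Ca H a x = syndrome H x ≈v a

  record Indexing (r : ℕ) : Set where
    field
      pos  : Fin (q ^ r) → V r
      inj  : ∀ k l → pos k ≈v pos l → k ≡ l
      surj : ∀ a → ∃[ k ] (pos k ≈v a)

  open Indexing public

  D : ∀ {r} → Indexing r → Code (q ^ r)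
  D ι y = (sum y ≡ 0#) × ((λ i → sum (λ k → y k * pos ι k i)) ≈v 0v)

  e : ∀ {r} → Indexing r → V r → Word (q ^ r)
  e ι a k = if does (pos ι k ≟v a) then 1# else 0#

  Da : ∀ {r} → Indexing r → V r → Code (q ^ r)
  Da ι a y = ∃[ d ] (D ι d × (∀ k → y k ≡ (d k + e ι 0v k) + (- e ι a k)))

  S : ∀ {r n} → (Fin n → V r) → Indexing r → (V r → V r) → Code (n ℕ.+ q ^ r)
  S H ι τ z = ∃[ a ] ∃[ x ] ∃[ y ] (Ca H a x × Da ι (τ a) y × z ≈w (x ++ y))

module Submission where

-- A word (x | y) lies in S_τ exactly when y satisfies the checks of H_D relative to x:
-- Σ y = 0 and Σ_a y_a a = −τ (H_C x). Perfectness is decoding: a word whose D-part has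
-- nonzero sum s is corrected by −s at the D-position named by the check values; otherwise
-- the correction lies in the C-part, where the Hamming syndromes of weight-one words are
-- pairwise distinct multiples of columns. For propelinearity, g = (a, M) ∈ G acts on the
-- C-part by the monomial map of M on the columns of H_C and on the D-part by the permutation
-- of positions induced by T g; suitable translations make these maps preserve S_τ, since
-- τ (g b) = T g (τ b), and they form a group acting regularly on S_τ because G acts
-- regularly on F_q^r.

open import Defs
open import Data.Nat as ℕ using (ℕ; zero; suc; _≤_; z≤n; _^_; _∸_)
import Data.Nat.Properties as ℕ
open import Data.Fin as Fin using (Fin; zero; suc; _↑ˡ_; _↑ʳ_; splitAt)
import Data.Fin.Properties as Fin
open import Data.Product using (_×_; _,_; proj₁; proj₂; ∃-syntax; Σ-syntax)
open import Data.Sum using (_⊎_; inj₁; inj₂)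
import Data.Sum.Properties as Sum
open import Data.Bool using (if_then_else_)
open import Data.Empty using (⊥-elim)
open import Function using (_∘′_)
open import Data.Vec.Functional using (_++_; take; drop)
open import Data.Vec.Functional.Properties using (lookup-++ˡ; lookup-++ʳ; ++-cong)
open import Data.Fin.Permutation using (permutation)
open import Relation.Nullary using (¬_; Dec; yes; no; does)
import Function.Bundles as Bundles
open import Relation.Nullary.Decidable using (dec-true; dec-false)
open import Relation.Binary.PropositionalEquality
open import Algebra.Bundles using (CommutativeRing)
open import Algebra.Definitions using (AlmostLeftCancellative)
import Algebra.Properties.Ring as RingProperties
import Algebra.Properties.CommutativeMonoid.Sum as MonoidSum

module _ {q : ℕ} (F : FiniteField q) where
  open FiniteField F
  open Codes F
  open ≡-Reasoning

  commutativeRing : CommutativeRing _ _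
  commutativeRing = record { isCommutativeRing = isCommutativeRing }

  open CommutativeRing commutativeRing
    using ( +-comm; +-assoc; +-identityˡ; +-identityʳ; -‿inverseˡ; -‿inverseʳ
          ; *-comm; *-assoc; *-identityˡ; *-identityʳ; distribˡ; distribʳ; zeroˡ; zeroʳ
          ; ring; +-commutativeMonoid )
  open RingProperties ring
    using ( -0#≈0#; -‿involutive; -‿+-comm; -‿distribˡ-*; -‿distribʳ-*
          ; +-cancelˡ; +-cancelʳ; +-inverseʳ-unique; x∙y⁻¹≈ε⇒x≈y
          ; //-rightDividesˡ; //-rightDividesʳ; \\-leftDividesˡ )

  1≢0 : 1# ≢ 0#
  1≢0 1≡0 = 0≢1 (sym 1≡0)

  *-almostCancelˡ : AlmostLeftCancellative _≡_ 0# _*_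
  *-almostCancelˡ x y z x≢0 xy≡xz with inverse x x≢0
  ... | x⁻¹ , xx⁻¹≡1 = begin
    y                ≡⟨ sym (trans (cong (_* y) x⁻¹x≡1) (*-identityˡ y)) ⟩
    (x⁻¹ * x) * y    ≡⟨ *-assoc x⁻¹ x y ⟩
    x⁻¹ * (x * y)    ≡⟨ cong (x⁻¹ *_) xy≡xz ⟩
    x⁻¹ * (x * z)    ≡⟨ sym (*-assoc x⁻¹ x z) ⟩
    (x⁻¹ * x) * z    ≡⟨ trans (cong (_* z) x⁻¹x≡1) (*-identityˡ z) ⟩
    z                ∎
    where
    x⁻¹x≡1 : x⁻¹ * x ≡ 1#
    x⁻¹x≡1 = trans (*-comm x⁻¹ x) xx⁻¹≡1

  x*y≡0⇒y≡0 : ∀ {x y} → x ≢ 0# → x * y ≡ 0# → y ≡ 0#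
  x*y≡0⇒y≡0 {x} {y} x≢0 xy≡0 = *-almostCancelˡ x y 0# x≢0 (trans xy≡0 (sym (zeroʳ x)))

  *-≢0 : ∀ {x y} → x ≢ 0# → y ≢ 0# → x * y ≢ 0#
  *-≢0 x≢0 y≢0 xy≡0 = y≢0 (x*y≡0⇒y≡0 x≢0 xy≡0)

  x+[y-x]≡y : ∀ x y → x + (y + - x) ≡ y
  x+[y-x]≡y x y = trans (+-comm x (y + - x)) (//-rightDividesˡ x y)

  sum-cong : ∀ {N} {f g : Fin N → Carrier} → (∀ i → f i ≡ g i) → sum f ≡ sum g
  sum-cong {zero}  f≗g = refl
  sum-cong {suc N} f≗g = cong₂ _+_ (f≗g zero) (sum-cong (λ i → f≗g (suc i)))

  sum-zero : ∀ N → sum {N} (λ _ → 0#) ≡ 0#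
  sum-zero zero    = refl
  sum-zero (suc N) = trans (+-identityˡ _) (sum-zero N)

  sum-distrib-+ : ∀ {N} (f g : Fin N → Carrier) → sum (λ i → f i + g i) ≡ sum f + sum g
  sum-distrib-+ {zero}  f g = sym (+-identityˡ 0#)
  sum-distrib-+ {suc N} f g = begin
    (f zero + g zero) + sum (λ i → f (suc i) + g (suc i))
      ≡⟨ cong ((f zero + g zero) +_) (sum-distrib-+ (λ i → f (suc i)) (λ i → g (suc i))) ⟩
    (f zero + g zero) + (Σf + Σg)   ≡⟨ +-assoc (f zero) (g zero) _ ⟩
    f zero + (g zero + (Σf + Σg))   ≡⟨ cong (f zero +_) (sym (+-assoc (g zero) Σf Σg)) ⟩
    f zero + ((g zero + Σf) + Σg)   ≡⟨ cong (λ t → f zero + (t + Σg)) (+-comm (g zero) Σf) ⟩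
    f zero + ((Σf + g zero) + Σg)   ≡⟨ cong (f zero +_) (+-assoc Σf (g zero) Σg) ⟩
    f zero + (Σf + (g zero + Σg))   ≡⟨ sym (+-assoc (f zero) Σf _) ⟩
    (f zero + Σf) + (g zero + Σg)   ∎
    where
    Σf Σg : Carrier
    Σf = sum (λ i → f (suc i))
    Σg = sum (λ i → g (suc i))

  sum-*ˡ : ∀ {N} c (f : Fin N → Carrier) → sum (λ i → c * f i) ≡ c * sum f
  sum-*ˡ {zero}  c f = sym (zeroʳ c)
  sum-*ˡ {suc N} c f =
    trans (cong (c * f zero +_) (sum-*ˡ c (λ i → f (suc i)))) (sym (distribˡ c _ _))

  sum-*ʳ : ∀ {N} c (f : Fin N → Carrier) → sum (λ i → f i * c) ≡ sum f * c
  sum-*ʳ c f = trans (sum-cong (λ i → *-comm (f i) c)) (trans (sum-*ˡ c f) (*-comm c _))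

  sum-neg : ∀ {N} (f : Fin N → Carrier) → sum (λ i → - f i) ≡ - sum f
  sum-neg {zero}  f = sym -0#≈0#
  sum-neg {suc N} f = trans (cong (- f zero +_) (sum-neg (λ i → f (suc i)))) (-‿+-comm _ _)

  sum-single : ∀ {N} (f : Fin N → Carrier) i → (∀ k → k ≢ i → f k ≡ 0#) → sum f ≡ f i
  sum-single {suc N} f zero f≡0 =
    trans (cong (f zero +_) (trans (sum-cong (λ k → f≡0 (suc k) (λ ()))) (sum-zero N)))
          (+-identityʳ _)
  sum-single {suc N} f (suc i) f≡0 =
    trans (cong (_+ sum (λ k → f (suc k))) (f≡0 zero (λ ())))
      (trans (+-identityˡ _)
        (sum-single (λ k → f (suc k)) i (λ k k≢i → f≡0 (suc k) (k≢i ∘′ Fin.suc-injective))))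

  private module ∑ = MonoidSum +-commutativeMonoid

  sum≡∑ : ∀ {N} (f : Fin N → Carrier) → sum f ≡ ∑.sum f
  sum≡∑ {zero}  f = refl
  sum≡∑ {suc N} f = cong (f zero +_) (sum≡∑ (λ i → f (suc i)))

  sum-comm : ∀ {M N} (f : Fin M → Fin N → Carrier) →
    sum (λ i → sum (f i)) ≡ sum (λ j → sum (λ i → f i j))
  sum-comm f = begin
    sum (λ i → sum (f i))               ≡⟨ sum-cong (λ i → sum≡∑ (f i)) ⟩
    sum (λ i → ∑.sum (f i))             ≡⟨ sum≡∑ (λ i → ∑.sum (f i)) ⟩
    ∑.sum (λ i → ∑.sum (f i))           ≡⟨ ∑.∑-comm f ⟩
    ∑.sum (λ j → ∑.sum (λ i → f i j))   ≡⟨ sym (sum≡∑ (λ j → ∑.sum (λ i → f i j))) ⟩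
    sum (λ j → ∑.sum (λ i → f i j))     ≡⟨ sym (sum-cong (λ j → sum≡∑ (λ i → f i j))) ⟩
    sum (λ j → sum (λ i → f i j))       ∎

  sum-permute : ∀ {N} (f : Fin N → Carrier) (π π⁻¹ : Fin N → Fin N) →
    (∀ i → π (π⁻¹ i) ≡ i) → (∀ i → π⁻¹ (π i) ≡ i) → sum f ≡ sum (λ i → f (π i))
  sum-permute f π π⁻¹ ππ⁻¹ π⁻¹π = begin
    sum f                  ≡⟨ sum≡∑ f ⟩
    ∑.sum f                ≡⟨ ∑.sum-permute f (permutation π π⁻¹ ππ⁻¹ π⁻¹π) ⟩
    ∑.sum (λ i → f (π i))  ≡⟨ sym (sum≡∑ (λ i → f (π i))) ⟩
    sum (λ i → f (π i))    ∎

  mismatch : Carrier → Carrier → ℕ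
  mismatch a b = if does (a ≟ b) then 0 else 1

  mismatch≤1 : ∀ a b → mismatch a b ≤ 1
  mismatch≤1 a b with a ≟ b
  ... | yes _ = z≤n
  ... | no _  = ℕ.≤-refl

  dist-cong : ∀ {N} {x x′ y y′ : Word N} → x ≈w x′ → y ≈w y′ → dist x y ≡ dist x′ y′
  dist-cong {zero}  x≈x′ y≈y′ = refl
  dist-cong {suc N} x≈x′ y≈y′ =
    cong₂ ℕ._+_ (cong₂ mismatch (x≈x′ zero) (y≈y′ zero))
                (dist-cong (λ i → x≈x′ (suc i)) (λ i → y≈y′ (suc i)))

  dist-refl : ∀ {N} (x : Word N) → dist x x ≡ 0
  dist-refl {zero}  x = refl
  dist-refl {suc N} x with x zero ≟ x zero
  ... | yes _  = dist-refl (λ i → x (suc i))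
  ... | no x≢x = ⊥-elim (x≢x refl)

  dist≡0⇒≈w : ∀ {N} (x y : Word N) → dist x y ≡ 0 → x ≈w y
  dist≡0⇒≈w {suc N} x y d≡0 with x zero ≟ y zero
  ... | no _    = ⊥-elim (ℕ.1+n≢0 d≡0)
  ... | yes x≡y = λ where
    zero    → x≡y
    (suc i) → dist≡0⇒≈w (λ i → x (suc i)) (λ i → y (suc i)) d≡0 i

  -- The index argument is only a default answer when x and y agree everywhere.
  dist≤1⇒agreeOff : ∀ {N} → Fin N → (x y : Word N) → dist x y ≤ 1 →
    ∃[ i ] (∀ k → k ≢ i → x k ≡ y k)
  dist≤1⇒agreeOff {suc N} i₀ x y d≤1 with x zero ≟ y zero
  ... | no _ = zero , λ where
    zero    k≢0 → ⊥-elim (k≢0 refl)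
    (suc k) _   → dist≡0⇒≈w (λ i → x (suc i)) (λ i → y (suc i)) (ℕ.n≤0⇒n≡0 (ℕ.≤-pred d≤1)) k
  dist≤1⇒agreeOff {suc zero}    i₀ x y d≤1 | yes x≡y = zero , λ { zero _ → x≡y }
  dist≤1⇒agreeOff {suc (suc N)} i₀ x y d≤1 | yes x≡y
    with dist≤1⇒agreeOff zero (λ i → x (suc i)) (λ i → y (suc i)) d≤1
  ... | i , agree = suc i , λ where
    zero    _     → x≡y
    (suc k) k≢1+i → agree k (k≢1+i ∘′ cong suc)

  agreeOff⇒dist≤1 : ∀ {N} (i : Fin N) (x y : Word N) → (∀ k → k ≢ i → x k ≡ y k) → dist x y ≤ 1
  agreeOff⇒dist≤1 {suc N} zero x y agree =
    ℕ.≤-trans (ℕ.≤-reflexive (trans (cong (mismatch (x zero) (y zero) ℕ.+_) tail≡0) (ℕ.+-identityʳ _)))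
              (mismatch≤1 (x zero) (y zero))
    where
    tail≡0 : dist (λ k → x (suc k)) (λ k → y (suc k)) ≡ 0
    tail≡0 = trans (dist-cong (λ k → agree (suc k) (λ ())) (λ _ → refl)) (dist-refl (λ k → y (suc k)))
  agreeOff⇒dist≤1 {suc N} (suc i) x y agree with x zero ≟ y zero
  ... | yes _   = agreeOff⇒dist≤1 i (λ k → x (suc k)) (λ k → y (suc k))
                    (λ k k≢i → agree (suc k) (k≢i ∘′ Fin.suc-injective))
  ... | no x≢y  = ⊥-elim (x≢y (agree zero (λ ())))

  private module ∑ℕ = MonoidSum ℕ.+-0-commutativeMonoid

  dist≡∑mismatch : ∀ {N} (x y : Word N) → dist x y ≡ ∑ℕ.sum (λ i → mismatch (x i) (y i))
  dist≡∑mismatch {zero}  x y = refl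
  dist≡∑mismatch {suc N} x y =
    cong (mismatch (x zero) (y zero) ℕ.+_) (dist≡∑mismatch (λ i → x (suc i)) (λ i → y (suc i)))

  mismatch-cong : ∀ {a b a′ b′} → (a ≡ b → a′ ≡ b′) → (a′ ≡ b′ → a ≡ b) →
    mismatch a b ≡ mismatch a′ b′
  mismatch-cong {a} {b} {a′} {b′} to from with a ≟ b | a′ ≟ b′
  ... | yes _   | yes _    = refl
  ... | no _    | no _     = refl
  ... | yes a≡b | no a′≢b′ = ⊥-elim (a′≢b′ (to a≡b))
  ... | no a≢b  | yes a′≡b′ = ⊥-elim (a≢b (from a′≡b′))

  dist-preserved : ∀ {N} (π π⁻¹ : Fin N → Fin N) → (∀ i → π (π⁻¹ i) ≡ i) → (∀ i → π⁻¹ (π i) ≡ i) →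
    (x y x′ y′ : Word N) →
    (∀ i → x (π i) ≡ y (π i) → x′ i ≡ y′ i) → (∀ i → x′ i ≡ y′ i → x (π i) ≡ y (π i)) →
    dist x′ y′ ≡ dist x y
  dist-preserved π π⁻¹ ππ⁻¹ π⁻¹π x y x′ y′ to from = begin
    dist x′ y′                                    ≡⟨ dist≡∑mismatch x′ y′ ⟩
    ∑ℕ.sum (λ i → mismatch (x′ i) (y′ i))         ≡⟨ ∑ℕ.sum-cong-≗ (λ i → mismatch-cong (from i) (to i)) ⟩
    ∑ℕ.sum (λ i → mismatch (x (π i)) (y (π i)))   ≡⟨ sym (∑ℕ.sum-permute _ (permutation π π⁻¹ ππ⁻¹ π⁻¹π)) ⟩
    ∑ℕ.sum (λ i → mismatch (x i) (y i))           ≡⟨ sym (dist≡∑mismatch x y) ⟩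
    dist x y                                      ∎

  splitAt-view : ∀ n m (i : Fin (n ℕ.+ m)) → (∃[ j ] (i ≡ j ↑ˡ m)) ⊎ (∃[ k ] (i ≡ n ↑ʳ k))
  splitAt-view n m i with splitAt n i in eq
  ... | inj₁ j = inj₁ (j , sym (Fin.splitAt⁻¹-↑ˡ eq))
  ... | inj₂ k = inj₂ (k , sym (Fin.splitAt⁻¹-↑ʳ eq))

  ↑ˡ≢↑ʳ : ∀ {n m} (j : Fin n) (k : Fin m) → j ↑ˡ m ≢ n ↑ʳ k
  ↑ˡ≢↑ʳ {n} {m} j k eq
    with trans (sym (Fin.splitAt-↑ˡ n j m)) (trans (cong (splitAt n) eq) (Fin.splitAt-↑ʳ n m k))
  ... | ()

  take++drop : ∀ n {m} (z : Word (n ℕ.+ m)) → z ≈w (take n z ++ drop n z)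
  take++drop n {m} z i = begin
    z i                                ≡⟨ cong z (sym (Fin.join-splitAt n m i)) ⟩
    z (Fin.join n m (splitAt n i))     ≡⟨ Sum.[,]-∘ z (splitAt n i) ⟩
    (take n z ++ drop n z) i           ∎

  dist-++ : ∀ {n m} (x x′ : Word n) (y y′ : Word m) →
    dist (x ++ y) (x′ ++ y′) ≡ dist x x′ ℕ.+ dist y y′
  dist-++ {zero}  x x′ y y′ = refl
  dist-++ {suc n} x x′ y y′ =
    trans (cong (mismatch (x zero) (x′ zero) ℕ.+_)
            (trans (dist-cong (tail-++ x y) (tail-++ x′ y′))
                   (dist-++ (λ i → x (suc i)) (λ i → x′ (suc i)) y y′)))
          (sym (ℕ.+-assoc (mismatch (x zero) (x′ zero)) _ _))
    where
    tail-++ : ∀ {m} (x : Word (suc n)) (y : Word m) → (λ i → (x ++ y) (suc i)) ≈w ((λ i → x (suc i)) ++ y)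
    tail-++ x y i with splitAt n i
    ... | inj₁ _ = refl
    ... | inj₂ _ = refl

  negv : ∀ {r} → V r → V r
  negv a i = - a i

  ·v-cong : ∀ {r} {M M′ : Matrix r} {a b : V r} → M ≈m M′ → a ≈v b → (M ·v a) ≈v (M′ ·v b)
  ·v-cong M≈M′ a≈b i = sum-cong (λ k → cong₂ _*_ (M≈M′ i k) (a≈b k))

  ·v-congʳ : ∀ {r} (M : Matrix r) {a b : V r} → a ≈v b → (M ·v a) ≈v (M ·v b)
  ·v-congʳ M = ·v-cong (λ _ _ → refl)

  ·v-distrib-+ : ∀ {r} (M : Matrix r) (a b : V r) → (M ·v (a +v b)) ≈v ((M ·v a) +v (M ·v b))
  ·v-distrib-+ M a b i =
    trans (sum-cong (λ k → distribˡ (M i k) (a k) (b k))) (sum-distrib-+ (λ k → M i k * a k) _)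

  ·v-• : ∀ {r} (M : Matrix r) c (a : V r) → (M ·v (c • a)) ≈v (c • (M ·v a))
  ·v-• M c a i = trans (sum-cong swap) (sum-*ˡ c (λ k → M i k * a k))
    where
    swap : ∀ k → M i k * (c * a k) ≡ c * (M i k * a k)
    swap k = trans (sym (*-assoc (M i k) c (a k)))
               (trans (cong (_* a k) (*-comm (M i k) c)) (*-assoc c (M i k) (a k)))

  ·v-0v : ∀ {r} (M : Matrix r) → (M ·v 0v) ≈v 0v
  ·v-0v {r} M i = trans (sum-cong (λ k → zeroʳ (M i k))) (sum-zero r)

  ·v-negv : ∀ {r} (M : Matrix r) (a : V r) → (M ·v negv a) ≈v negv (M ·v a)
  ·v-negv M a i = trans (sum-cong (λ k → sym (-‿distribʳ-* (M i k) (a k)))) (sum-neg (λ k → M i k * a k))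

  ·m-·v : ∀ {r} (M M′ : Matrix r) (a : V r) → ((M ·m M′) ·v a) ≈v (M ·v (M′ ·v a))
  ·m-·v M M′ a i = begin
    sum (λ k → sum (λ l → M i l * M′ l k) * a k)   ≡⟨ sum-cong (λ k → sym (sum-*ʳ (a k) (λ l → M i l * M′ l k))) ⟩
    sum (λ k → sum (λ l → (M i l * M′ l k) * a k)) ≡⟨ sum-comm (λ k l → (M i l * M′ l k) * a k) ⟩
    sum (λ l → sum (λ k → (M i l * M′ l k) * a k)) ≡⟨ sum-cong (λ l → trans (sum-cong (λ k → *-assoc (M i l) (M′ l k) (a k)))
                                                              (sum-*ˡ (M i l) (λ k → M′ l k * a k))) ⟩
    sum (λ l → M i l * sum (λ k → M′ l k * a k))   ∎

  idM-·v : ∀ {r} (a : V r) → (idM ·v a) ≈v a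
  idM-·v a i = trans (sum-single _ i off-diagonal) (trans (cong (_* a i) diagonal) (*-identityˡ (a i)))
    where
    diagonal : idM i i ≡ 1#
    diagonal with i Fin.≟ i
    ... | yes _   = refl
    ... | no i≢i  = ⊥-elim (i≢i refl)
    off-diagonal : ∀ k → k ≢ i → idM i k * a k ≡ 0#
    off-diagonal k k≢i with i Fin.≟ k
    ... | yes i≡k = ⊥-elim (k≢i (sym i≡k))
    ... | no _    = zeroˡ (a k)

  idM-·m-idM : ∀ {r} → (idM {r} ·m idM) ≈m idM
  idM-·m-idM i j = idM-·v (λ k → idM k j) i

  ≈m-sym : ∀ {r} {M M′ : Matrix r} → M ≈m M′ → M′ ≈m M
  ≈m-sym M≈M′ i j = sym (M≈M′ i j)

  leftInverse-·v : ∀ {r} {M M′ : Matrix r} → (M′ ·m M) ≈m idM → ∀ a → (M′ ·v (M ·v a)) ≈v a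
  leftInverse-·v {M = M} {M′} M′M≈I a i = begin
    (M′ ·v (M ·v a)) i   ≡⟨ sym (·m-·v M′ M a i) ⟩
    ((M′ ·m M) ·v a) i   ≡⟨ ·v-cong M′M≈I (λ _ → refl) i ⟩
    (idM ·v a) i         ≡⟨ idM-·v a i ⟩
    a i                  ∎

  syndrome-cong : ∀ {r m} {H H′ : Fin m → V r} {x x′ : Word m} →
    (∀ j → H j ≈v H′ j) → x ≈w x′ → syndrome H x ≈v syndrome H′ x′
  syndrome-cong H≈H′ x≈x′ i = sum-cong (λ j → cong₂ _*_ (H≈H′ j i) (x≈x′ j))

  syndrome-congʳ : ∀ {r m} (H : Fin m → V r) {x x′ : Word m} → x ≈w x′ → syndrome H x ≈v syndrome H x′
  syndrome-congʳ H = syndrome-cong (λ _ _ → refl)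

  syndrome-+ : ∀ {r m} (H : Fin m → V r) (x y : Word m) →
    syndrome H (λ j → x j + y j) ≈v (syndrome H x +v syndrome H y)
  syndrome-+ H x y i =
    trans (sum-cong (λ j → distribˡ (H j i) (x j) (y j))) (sum-distrib-+ (λ j → H j i * x j) _)

  syndrome-neg : ∀ {r m} (H : Fin m → V r) (x : Word m) → syndrome H (λ j → - x j) ≈v negv (syndrome H x)
  syndrome-neg H x i =
    trans (sum-cong (λ j → sym (-‿distribʳ-* (H j i) (x j)))) (sum-neg (λ j → H j i * x j))

  syndrome-zero : ∀ {r m} (H : Fin m → V r) → syndrome H (λ _ → 0#) ≈v 0v
  syndrome-zero {m = m} H i = trans (sum-cong (λ j → zeroʳ (H j i))) (sum-zero m)

  ·v-syndrome : ∀ {r m} (M : Matrix r) (H : Fin m → V r) (x : Word m) →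
    (M ·v syndrome H x) ≈v syndrome (λ j → M ·v H j) x
  ·v-syndrome M H x i = begin
    sum (λ k → M i k * sum (λ j → H j k * x j))     ≡⟨ sum-cong (λ k → sym (sum-*ˡ (M i k) (λ j → H j k * x j))) ⟩
    sum (λ k → sum (λ j → M i k * (H j k * x j)))   ≡⟨ sum-comm (λ k j → M i k * (H j k * x j)) ⟩
    sum (λ j → sum (λ k → M i k * (H j k * x j)))   ≡⟨ sum-cong (λ j → trans (sum-cong (λ k → sym (*-assoc (M i k) (H j k) (x j))))
                                                                (sum-*ʳ (x j) (λ k → M i k * H j k))) ⟩
    sum (λ j → sum (λ k → M i k * H j k) * x j)     ∎

  unit : ∀ {N} → Fin N → Carrier → Word N
  unit j δ k = if does (k Fin.≟ j) then δ else 0#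

  unit-at : ∀ {N} (j : Fin N) δ → unit j δ j ≡ δ
  unit-at j δ with j Fin.≟ j
  ... | yes _   = refl
  ... | no j≢j  = ⊥-elim (j≢j refl)

  unit-off : ∀ {N} (j k : Fin N) δ → k ≢ j → unit j δ k ≡ 0#
  unit-off j k δ k≢j with k Fin.≟ j
  ... | yes k≡j = ⊥-elim (k≢j k≡j)
  ... | no _    = refl

  unit-zero : ∀ {N} (j k : Fin N) → unit j 0# k ≡ 0#
  unit-zero j k with k Fin.≟ j
  ... | yes _ = refl
  ... | no _  = refl

  unit-↑ˡ : ∀ {n m} (j j′ : Fin n) δ → unit (j ↑ˡ m) δ (j′ ↑ˡ m) ≡ unit j δ j′
  unit-↑ˡ {m = m} j j′ δ with j′ Fin.≟ j
  ... | yes refl  = unit-at (j ↑ˡ m) δ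
  ... | no j′≢j   = unit-off (j ↑ˡ m) (j′ ↑ˡ m) δ (j′≢j ∘′ Fin.↑ˡ-injective m j′ j)

  unit-↑ʳ : ∀ {n m} (k k′ : Fin m) δ → unit (n ↑ʳ k) δ (n ↑ʳ k′) ≡ unit k δ k′
  unit-↑ʳ {n} k k′ δ with k′ Fin.≟ k
  ... | yes refl  = unit-at (n ↑ʳ k) δ
  ... | no k′≢k   = unit-off (n ↑ʳ k) (n ↑ʳ k′) δ (k′≢k ∘′ Fin.↑ʳ-injective n k′ k)

  unit-↑ˡ-↑ʳ : ∀ {n m} (j : Fin n) (k : Fin m) δ → unit (j ↑ˡ m) δ (n ↑ʳ k) ≡ 0#
  unit-↑ˡ-↑ʳ j k δ = unit-off (j ↑ˡ _) (_ ↑ʳ k) δ (↑ˡ≢↑ʳ j k ∘′ sym)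

  unit-↑ʳ-↑ˡ : ∀ {n m} (j : Fin n) (k : Fin m) δ → unit (n ↑ʳ k) δ (j ↑ˡ m) ≡ 0#
  unit-↑ʳ-↑ˡ j k δ = unit-off (_ ↑ʳ k) (j ↑ˡ _) δ (↑ˡ≢↑ʳ j k)

  unit-↑ˡ-cong : ∀ {n m} {j j′ : Fin n} {δ δ′} → unit j δ ≈w unit j′ δ′ →
    unit {n ℕ.+ m} (j ↑ˡ m) δ ≈w unit (j′ ↑ˡ m) δ′
  unit-↑ˡ-cong {n} {m} {j} {j′} {δ} {δ′} unit≈unit i with splitAt-view n m i
  ... | inj₁ (j″ , refl) = trans (unit-↑ˡ j j″ δ) (trans (unit≈unit j″) (sym (unit-↑ˡ j′ j″ δ′)))
  ... | inj₂ (k , refl)  = trans (unit-↑ˡ-↑ʳ j k δ) (sym (unit-↑ˡ-↑ʳ j′ k δ′))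

  sum-unit : ∀ {N} (j : Fin N) δ → sum (unit j δ) ≡ δ
  sum-unit j δ = trans (sum-single (unit j δ) j (λ k k≢j → unit-off j k δ k≢j)) (unit-at j δ)

  syndrome-unit : ∀ {r m} (H : Fin m → V r) j δ → syndrome H (unit j δ) ≈v (δ • H j)
  syndrome-unit H j δ i =
    trans (sum-single _ j (λ k k≢j → trans (cong (H k i *_) (unit-off j k δ k≢j)) (zeroʳ _)))
          (trans (cong (H j i *_) (unit-at j δ)) (*-comm _ _))

  infixl 6 _[_]+=_
  _[_]+=_ : ∀ {N} → Word N → Fin N → Carrier → Word N
  (z [ i ]+= δ) k = z k + unit i δ k

  dist-[]+= : ∀ {N} (z : Word N) i δ → dist z (z [ i ]+= δ) ≤ 1
  dist-[]+= z i δ =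
    agreeOff⇒dist≤1 i z (z [ i ]+= δ) (λ k k≢i → sym (trans (cong (z k +_) (unit-off i k δ k≢i)) (+-identityʳ _)))

  dist≤1⇒[]+= : ∀ {N} → Fin N → (z c : Word N) → dist z c ≤ 1 → ∃[ i ] ∃[ δ ] (c ≈w (z [ i ]+= δ))
  dist≤1⇒[]+= i₀ z c d≤1 with dist≤1⇒agreeOff i₀ z c d≤1
  ... | i , agree = i , c i + - z i , λ k → at k (k Fin.≟ i)
    where
    at : ∀ k → Dec (k ≡ i) → c k ≡ z k + unit i (c i + - z i) k
    at k (yes refl) = sym (trans (cong (z k +_) (unit-at k _)) (x+[y-x]≡y (z k) (c k)))
    at k (no k≢i)   = sym (trans (cong (z k +_) (unit-off i k _ k≢i)) (trans (+-identityʳ _) (agree k k≢i)))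

  act-cong : ∀ {r} {g h : Aff r} {a b : V r} → g ≈A h → a ≈v b → act g a ≈v act h b
  act-cong (shift≈ , lin≈) a≈b i = cong₂ _+_ (shift≈ i) (·v-cong lin≈ a≈b i)

  act-∘A : ∀ {r} (g h : Aff r) (b : V r) → act (g ∘A h) b ≈v act g (act h b)
  act-∘A g h b i = begin
    (shift g i + (lin g ·v shift h) i) + ((lin g ·m lin h) ·v b) i
      ≡⟨ cong ((shift g i + (lin g ·v shift h) i) +_) (·m-·v (lin g) (lin h) b i) ⟩
    (shift g i + (lin g ·v shift h) i) + (lin g ·v (lin h ·v b)) i
      ≡⟨ +-assoc _ _ _ ⟩
    shift g i + ((lin g ·v shift h) i + (lin g ·v (lin h ·v b)) i)
      ≡⟨ cong (shift g i +_) (sym (·v-distrib-+ (lin g) (shift h) (lin h ·v b) i)) ⟩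
    shift g i + (lin g ·v (shift h +v (lin h ·v b))) i ∎

  act-idA : ∀ {r} (b : V r) → act idA b ≈v b
  act-idA b i = trans (+-identityˡ _) (idM-·v b i)

  ≈A-refl : ∀ {r} {g : Aff r} → g ≈A g
  ≈A-refl = (λ _ → refl) , (λ _ _ → refl)

  ≈A-sym : ∀ {r} {g h : Aff r} → g ≈A h → h ≈A g
  ≈A-sym (s , l) = (λ i → sym (s i)) , (λ i j → sym (l i j))

  ≈A-trans : ∀ {r} {g h k : Aff r} → g ≈A h → h ≈A k → g ≈A k
  ≈A-trans (s , l) (s′ , l′) = (λ i → trans (s i) (s′ i)) , (λ i j → trans (l i j) (l′ i j))

  idA-∘A-idA : ∀ {r} → (idA {r} ∘A idA) ≈A idA
  idA-∘A-idA = act-idA 0v , idM-·m-idM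

  module _ {r} {G : Aff r → Set} {T : Aff r → Aff r} where

    T-idA : IsSubgroupGA G → IsRegular G → IsAutomorphism G T → T idA ≈A idA
    T-idA (_ , _ , G-idA , G-∘A , _) (_ , free) (T-closed , T-cong , T-hom , _) =
      free t idA (act t 0v) (T-closed idA G-idA) G-idA t[t0]≈t0
      where
      t = T idA
      t≈t∘t : t ≈A (t ∘A t)
      t≈t∘t = ≈A-trans (T-cong idA (idA ∘A idA) G-idA (G-∘A idA idA G-idA G-idA) (≈A-sym idA-∘A-idA))
                       (T-hom idA idA G-idA G-idA)
      t[t0]≈t0 : act t (act t 0v) ≈v act idA (act t 0v)
      t[t0]≈t0 i = trans (sym (act-∘A t t 0v i)) (trans (act-cong (≈A-sym t≈t∘t) (λ _ → refl) i)
                                                        (sym (act-idA (act t 0v) i)))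

    module _ {τ : V r → V r} where

      τ-cong : IsRegular G → IsInducedPerm G T τ → ∀ a b → a ≈v b → τ a ≈v τ b
      τ-cong (transitive , _) induced a b a≈b i with transitive 0v a
      ... | g , Gg , g0≈a = trans (sym (induced a g Gg g0≈a i)) (induced b g Gg (λ i → trans (g0≈a i) (a≈b i)) i)

      τ-injective : IsRegular G → IsAutomorphism G T → IsInducedPerm G T τ →
        ∀ a b → τ a ≈v τ b → a ≈v b
      τ-injective (transitive , free) (T-closed , _ , _ , T-injective , _) induced a b τa≈τb i
        with transitive 0v a | transitive 0v b
      ... | gₐ , Ggₐ , gₐ0≈a | g_b , Gg_b , g_b0≈b =
        trans (sym (gₐ0≈a i)) (trans (act-cong gₐ≈g_b (λ _ → refl) i) (g_b0≈b i))
        where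
        Tgₐ≈Tg_b : T gₐ ≈A T g_b
        Tgₐ≈Tg_b = free (T gₐ) (T g_b) 0v (T-closed gₐ Ggₐ) (T-closed g_b Gg_b)
          (λ i → trans (induced a gₐ Ggₐ gₐ0≈a i) (trans (τa≈τb i) (sym (induced b g_b Gg_b g_b0≈b i))))
        gₐ≈g_b : gₐ ≈A g_b
        gₐ≈g_b = T-injective gₐ g_b Ggₐ Gg_b Tgₐ≈Tg_b

      τ-surjective : IsRegular G → IsAutomorphism G T → IsInducedPerm G T τ → ∀ t → ∃[ a ] (τ a ≈v t)
      τ-surjective (transitive , _) (_ , _ , _ , _ , T-surjective) induced t with transitive 0v t
      ... | gₜ , Ggₜ , gₜ0≈t with T-surjective gₜ Ggₜ
      ... | g , Gg , Tg≈gₜ =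
        act g 0v , λ i → trans (sym (induced (act g 0v) g Gg (λ _ → refl) i))
                                     (trans (act-cong Tg≈gₜ (λ _ → refl) i) (gₜ0≈t i))

      -- With g_a the element sending 0 to a: g ∘ g_a = g_{g a}, hence T g ∘ g_{τ a} = g_{τ (g a)}.
      τ-equivariant : IsSubgroupGA G → IsRegular G → IsAutomorphism G T → IsInducedPerm G T τ →
        ∀ g → G g → ∀ a → τ (act g a) ≈v act (T g) (τ a)
      τ-equivariant (_ , _ , _ , G-∘A , _) (transitive , _) (_ , _ , T-hom , _) induced g Gg a i
        with transitive 0v a
      ... | gₐ , Ggₐ , gₐ0≈a = begin
        τ (act g a) i                  ≡⟨ sym (induced (act g a) (g ∘A gₐ) (G-∘A g gₐ Gg Ggₐ) g∘gₐ0≈ga i) ⟩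
        act (T (g ∘A gₐ)) 0v i         ≡⟨ act-cong (T-hom g gₐ Gg Ggₐ) (λ _ → refl) i ⟩
        act (T g ∘A T gₐ) 0v i         ≡⟨ act-∘A (T g) (T gₐ) 0v i ⟩
        act (T g) (act (T gₐ) 0v) i    ≡⟨ act-cong (≈A-refl {g = T g}) (induced a gₐ Ggₐ gₐ0≈a) i ⟩
        act (T g) (τ a) i              ∎
        where
        g∘gₐ0≈ga : act (g ∘A gₐ) 0v ≈v act g a
        g∘gₐ0≈ga i = trans (act-∘A g gₐ 0v i) (act-cong (≈A-refl {g = g}) gₐ0≈a i)

  module _ {r} (ι : Indexing r) where

    e≈unit : ∀ {a} k → pos ι k ≈v a → e ι a ≈w unit k 1#
    e≈unit {a} k pk≈a k′ with k′ Fin.≟ k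
    ... | yes refl  = cong (if_then 1# else 0#) (dec-true (pos ι k′ ≟v a) pk≈a)
    ... | no k′≢k   = cong (if_then 1# else 0#) (dec-false (pos ι k′ ≟v a) pk′≉a)
      where
      pk′≉a : ¬ (pos ι k′ ≈v a)
      pk′≉a pk′≈a = k′≢k (inj ι k′ k (λ i → trans (pk′≈a i) (sym (pk≈a i))))

    sum-e : ∀ a → sum (e ι a) ≡ 1#
    sum-e a with surj ι a
    ... | k , pk≈a = trans (sum-cong (e≈unit k pk≈a)) (sum-unit k 1#)

    syndrome-e : ∀ a → syndrome (pos ι) (e ι a) ≈v a
    syndrome-e a i with surj ι a
    ... | k , pk≈a = trans (syndrome-congʳ (pos ι) (e≈unit k pk≈a) i)
                       (trans (syndrome-unit (pos ι) k 1# i) (trans (*-identityˡ _) (pk≈a i)))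

    D-syndrome : ∀ (y : Word (q ^ r)) → (λ i → sum (λ k → y k * pos ι k i)) ≈v syndrome (pos ι) y
    D-syndrome y i = sum-cong (λ k → *-comm (y k) (pos ι k i))

    private
      sum-+-neg : ∀ {N} (f g h : Word N) → sum (λ k → (f k + g k) + - h k) ≡ (sum f + sum g) + - sum h
      sum-+-neg f g h =
        trans (sum-distrib-+ (λ k → f k + g k) (λ k → - h k)) (cong₂ _+_ (sum-distrib-+ f g) (sum-neg h))

      syndrome-+-neg : ∀ {N} (P : Fin N → V r) (f g h : Word N) →
        syndrome P (λ k → (f k + g k) + - h k) ≈v λ i → (syndrome P f i + syndrome P g i) + - syndrome P h i
      syndrome-+-neg P f g h i =
        trans (syndrome-+ P (λ k → f k + g k) (λ k → - h k) i)
              (cong₂ _+_ (syndrome-+ P f g i) (syndrome-neg P h i))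

    -- e_0 and e_t have H_D-syndromes (1, 0) and (1, t), so D_t consists of the words of H_D-syndrome (0, −t).
    Da⇒checks : ∀ {t y} → Da ι t y → (sum y ≡ 0#) × (syndrome (pos ι) y ≈v negv t)
    Da⇒checks {t} {y} (d , (Σd≡0 , Pd≈0) , y≈d+e₀-eₜ) = Σy≡0 , Py≈-t
      where
      Σy≡0 : sum y ≡ 0#
      Σy≡0 = begin
        sum y                                      ≡⟨ sum-cong y≈d+e₀-eₜ ⟩
        sum (λ k → (d k + e ι 0v k) + - e ι t k)   ≡⟨ sum-+-neg d (e ι 0v) (e ι t) ⟩
        (sum d + sum (e ι 0v)) + - sum (e ι t)     ≡⟨ cong₂ (λ s u → (s + u) + - sum (e ι t)) Σd≡0 (sum-e 0v) ⟩
        (0# + 1#) + - sum (e ι t)                  ≡⟨ cong (λ u → (0# + 1#) + - u) (sum-e t) ⟩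
        (0# + 1#) + - 1#                           ≡⟨ //-rightDividesʳ 1# 0# ⟩
        0#                                         ∎
      Py≈-t : syndrome (pos ι) y ≈v negv t
      Py≈-t i = begin
        syndrome (pos ι) y i                                           ≡⟨ syndrome-congʳ (pos ι) y≈d+e₀-eₜ i ⟩
        syndrome (pos ι) (λ k → (d k + e ι 0v k) + - e ι t k) i        ≡⟨ syndrome-+-neg (pos ι) d (e ι 0v) (e ι t) i ⟩
        (syndrome (pos ι) d i + syndrome (pos ι) (e ι 0v) i) + - syndrome (pos ι) (e ι t) i
          ≡⟨ cong₂ (λ s u → (s + u) + - syndrome (pos ι) (e ι t) i) (trans (sym (D-syndrome d i)) (Pd≈0 i)) (syndrome-e 0v i) ⟩
        (0# + 0#) + - syndrome (pos ι) (e ι t) i                       ≡⟨ cong₂ (λ s u → s + - u) (+-identityˡ 0#) (syndrome-e t i) ⟩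
        0# + - t i                                                     ≡⟨ +-identityˡ _ ⟩
        - t i                                                          ∎

    checks⇒Da : ∀ {t y} → sum y ≡ 0# → syndrome (pos ι) y ≈v negv t → Da ι t y
    checks⇒Da {t} {y} Σy≡0 Py≈-t = d , (Σd≡0 , Pd≈0) , y≈d+e₀-eₜ
      where
      d : Word (q ^ r)
      d k = (y k + e ι t k) + - e ι 0v k
      y≈d+e₀-eₜ : ∀ k → y k ≡ (d k + e ι 0v k) + - e ι t k
      y≈d+e₀-eₜ k = sym (trans (cong (_+ - e ι t k) (//-rightDividesˡ (e ι 0v k) (y k + e ι t k)))
                                (//-rightDividesʳ (e ι t k) (y k)))
      Σd≡0 : sum d ≡ 0#
      Σd≡0 = begin
        sum d                                    ≡⟨ sum-+-neg y (e ι t) (e ι 0v) ⟩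
        (sum y + sum (e ι t)) + - sum (e ι 0v)   ≡⟨ cong₂ (λ s u → (s + u) + - sum (e ι 0v)) Σy≡0 (sum-e t) ⟩
        (0# + 1#) + - sum (e ι 0v)               ≡⟨ cong (λ u → (0# + 1#) + - u) (sum-e 0v) ⟩
        (0# + 1#) + - 1#                         ≡⟨ //-rightDividesʳ 1# 0# ⟩
        0#                                       ∎
      Pd≈0 : (λ i → sum (λ k → d k * pos ι k i)) ≈v 0v
      Pd≈0 i = begin
        sum (λ k → d k * pos ι k i)                                     ≡⟨ D-syndrome d i ⟩
        syndrome (pos ι) d i                                            ≡⟨ syndrome-+-neg (pos ι) y (e ι t) (e ι 0v) i ⟩
        (syndrome (pos ι) y i + syndrome (pos ι) (e ι t) i) + - syndrome (pos ι) (e ι 0v) i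
          ≡⟨ cong₂ (λ s u → (s + u) + - syndrome (pos ι) (e ι 0v) i) (Py≈-t i) (syndrome-e t i) ⟩
        (- t i + t i) + - syndrome (pos ι) (e ι 0v) i                   ≡⟨ cong₂ (λ s u → s + - u) (-‿inverseˡ (t i)) (syndrome-e 0v i) ⟩
        0# + - 0#                                                       ≡⟨ -‿inverseʳ 0# ⟩
        0#                                                              ∎

  •-≈0v⇒≡0 : ∀ {r} {v : V r} δ → ¬ (v ≈v 0v) → (δ • v) ≈v 0v → δ ≡ 0#
  •-≈0v⇒≡0 δ v≉0 δv≈0 with δ ≟ 0#
  ... | yes δ≡0 = δ≡0
  ... | no δ≢0  = ⊥-elim (v≉0 (λ i → x*y≡0⇒y≡0 δ≢0 (δv≈0 i)))

  module _ {r n} {H : Fin n → V r} (hamming : IsHammingPCM H) where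

    private
      column≉0 : ∀ j → ¬ (H j ≈v 0v)
      column≉0 = proj₁ hamming

      columns-independent : ∀ j k λ′ → H j ≈v (λ′ • H k) → j ≡ k
      columns-independent = proj₁ (proj₂ hamming)

    •-column-injective : ∀ {j j′ δ δ′} → δ ≢ 0# → (δ • H j) ≈v (δ′ • H j′) → (j ≡ j′) × (δ ≡ δ′)
    •-column-injective {j} {j′} {δ} {δ′} δ≢0 δHj≈δ′Hj′ with inverse δ δ≢0
    ... | δ⁻¹ , δδ⁻¹≡1 with columns-independent j j′ (δ⁻¹ * δ′) Hj≈δ⁻¹δ′Hj′
      where
      Hj≈δ⁻¹δ′Hj′ : H j ≈v ((δ⁻¹ * δ′) • H j′)
      Hj≈δ⁻¹δ′Hj′ i = begin
        H j i                  ≡⟨ sym (*-identityˡ _) ⟩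
        1# * H j i             ≡⟨ cong (_* H j i) (trans (sym δδ⁻¹≡1) (*-comm δ δ⁻¹)) ⟩
        (δ⁻¹ * δ) * H j i      ≡⟨ *-assoc δ⁻¹ δ _ ⟩
        δ⁻¹ * (δ * H j i)      ≡⟨ cong (δ⁻¹ *_) (δHj≈δ′Hj′ i) ⟩
        δ⁻¹ * (δ′ * H j′ i)    ≡⟨ sym (*-assoc δ⁻¹ δ′ _) ⟩
        (δ⁻¹ * δ′) * H j′ i    ∎
    ... | refl = refl , x∙y⁻¹≈ε⇒x≈y δ δ′ (•-≈0v⇒≡0 (δ + - δ′) (column≉0 j) [δ-δ′]Hj≈0)
      where
      [δ-δ′]Hj≈0 : ((δ + - δ′) • H j) ≈v 0v
      [δ-δ′]Hj≈0 i = begin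
        (δ + - δ′) * H j i            ≡⟨ distribʳ (H j i) δ (- δ′) ⟩
        δ * H j i + - δ′ * H j i      ≡⟨ cong₂ _+_ (δHj≈δ′Hj′ i) (sym (-‿distribˡ-* δ′ (H j i))) ⟩
        δ′ * H j i + - (δ′ * H j i)   ≡⟨ -‿inverseʳ _ ⟩
        0#                            ∎

    unit-syndrome-injective : ∀ j j′ δ δ′ → (δ • H j) ≈v (δ′ • H j′) → unit j δ ≈w unit j′ δ′
    unit-syndrome-injective j j′ δ δ′ δHj≈δ′Hj′ with δ ≟ 0#
    ... | no δ≢0 with •-column-injective δ≢0 δHj≈δ′Hj′
    ...   | refl , refl = λ _ → refl
    unit-syndrome-injective j j′ δ δ′ δHj≈δ′Hj′ | yes refl
      with •-≈0v⇒≡0 δ′ (column≉0 j′) (λ i → trans (sym (δHj≈δ′Hj′ i)) (zeroˡ _))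
    ... | refl = λ k → trans (unit-zero j k) (sym (unit-zero j′ k))

  -- A monomial map sends coordinate j to coordinate perm j, multiplied by scale j.
  record Monomial (N : ℕ) : Set where
    field
      perm perm⁻¹ : Fin N → Fin N
      perm∘perm⁻¹ : ∀ i → perm (perm⁻¹ i) ≡ i
      perm⁻¹∘perm : ∀ j → perm⁻¹ (perm j) ≡ j
      scale       : Fin N → Carrier
      scale≢0     : ∀ j → scale j ≢ 0#

  open Monomial

  apply : ∀ {N} → Monomial N → Word N → Word N
  apply m x i = scale m (perm⁻¹ m i) * x (perm⁻¹ m i)

  idₘ : ∀ {N} → Monomial N
  idₘ = record { perm = λ j → j ; perm⁻¹ = λ j → j ; perm∘perm⁻¹ = λ _ → refl ; perm⁻¹∘perm = λ _ → refl
               ; scale = λ _ → 1# ; scale≢0 = λ _ → 1≢0 }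

  infixr 9 _∘ₘ_
  _∘ₘ_ : ∀ {N} → Monomial N → Monomial N → Monomial N
  m₁ ∘ₘ m₂ = record
    { perm        = λ j → perm m₁ (perm m₂ j)
    ; perm⁻¹      = λ i → perm⁻¹ m₂ (perm⁻¹ m₁ i)
    ; perm∘perm⁻¹ = λ i → trans (cong (perm m₁) (perm∘perm⁻¹ m₂ _)) (perm∘perm⁻¹ m₁ i)
    ; perm⁻¹∘perm = λ j → trans (cong (perm⁻¹ m₂) (perm⁻¹∘perm m₁ _)) (perm⁻¹∘perm m₂ j)
    ; scale       = λ j → scale m₂ j * scale m₁ (perm m₂ j)
    ; scale≢0     = λ j → *-≢0 (scale≢0 m₂ j) (scale≢0 m₁ _)
    }

  UnitScaled : ∀ {N} → Monomial N → Set
  UnitScaled m = ∀ j → scale m j ≡ 1#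

  ∘ₘ-unitScaled : ∀ {N} (m₁ m₂ : Monomial N) → UnitScaled m₁ → UnitScaled m₂ → UnitScaled (m₁ ∘ₘ m₂)
  ∘ₘ-unitScaled m₁ m₂ unit₁ unit₂ j = trans (cong₂ _*_ (unit₂ j) (unit₁ _)) (*-identityˡ 1#)

  apply-cong : ∀ {N} (m : Monomial N) {x y} → x ≈w y → apply m x ≈w apply m y
  apply-cong m x≈y i = cong (scale m (perm⁻¹ m i) *_) (x≈y _)

  apply-+ : ∀ {N} (m : Monomial N) x y → apply m (λ i → x i + y i) ≈w (λ i → apply m x i + apply m y i)
  apply-+ m x y i = distribˡ _ _ _

  apply-neg : ∀ {N} (m : Monomial N) x → apply m (λ i → - x i) ≈w (λ i → - apply m x i)
  apply-neg m x i = sym (-‿distribʳ-* _ _)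

  apply-idₘ : ∀ {N} (x : Word N) → apply idₘ x ≈w x
  apply-idₘ x i = *-identityˡ (x i)

  apply-∘ₘ : ∀ {N} (m₁ m₂ : Monomial N) x → apply m₁ (apply m₂ x) ≈w apply (m₁ ∘ₘ m₂) x
  apply-∘ₘ m₁ m₂ x i = begin
    scale m₁ i₁ * (scale m₂ j * x j)           ≡⟨ sym (*-assoc _ _ _) ⟩
    (scale m₁ i₁ * scale m₂ j) * x j           ≡⟨ cong (_* x j) (*-comm _ _) ⟩
    (scale m₂ j * scale m₁ i₁) * x j           ≡⟨ cong (λ t → (scale m₂ j * scale m₁ t) * x j) (sym (perm∘perm⁻¹ m₂ i₁)) ⟩
    (scale m₂ j * scale m₁ (perm m₂ j)) * x j  ∎
    where
    i₁ j : Fin _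
    i₁ = perm⁻¹ m₁ i
    j  = perm⁻¹ m₂ i₁

  apply-cong-monomial : ∀ {N} (m m′ : Monomial N) → (∀ j → perm m j ≡ perm m′ j) → (∀ j → scale m j ≡ scale m′ j) →
    ∀ x → apply m x ≈w apply m′ x
  apply-cong-monomial m m′ perm≡ scale≡ x i =
    trans (cong (λ j → scale m j * x j) perm⁻¹≡) (cong (_* x (perm⁻¹ m′ i)) (scale≡ _))
    where
    perm⁻¹≡ : perm⁻¹ m i ≡ perm⁻¹ m′ i
    perm⁻¹≡ = trans (cong (perm⁻¹ m) (trans (sym (perm∘perm⁻¹ m′ i)) (sym (perm≡ _)))) (perm⁻¹∘perm m _)

  dist-apply-+ : ∀ {N} (m : Monomial N) (u : Word N) x y →
    dist (λ i → apply m x i + u i) (λ i → apply m y i + u i) ≡ dist x y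
  dist-apply-+ m u x y = dist-preserved (perm⁻¹ m) (perm m) (perm⁻¹∘perm m) (perm∘perm⁻¹ m) x y _ _
    (λ i x≡y → cong (λ t → scale m (perm⁻¹ m i) * t + u i) x≡y)
    (λ i eq → *-almostCancelˡ _ _ _ (scale≢0 m _) (+-cancelʳ (u i) _ _ eq))

  sum-apply : ∀ {N} (m : Monomial N) → UnitScaled m → ∀ x → sum (apply m x) ≡ sum x
  sum-apply m unitScaled x = begin
    sum (apply m x)                   ≡⟨ sum-cong (λ i → trans (cong (_* x (perm⁻¹ m i)) (unitScaled _)) (*-identityˡ _)) ⟩
    sum (λ i → x (perm⁻¹ m i))        ≡⟨ sym (sum-permute x (perm⁻¹ m) (perm m) (perm⁻¹∘perm m) (perm∘perm⁻¹ m)) ⟩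
    sum x                             ∎

  record Represents {r N} (P : Fin N → V r) (M : Matrix r) (m : Monomial N) : Set where
    constructor representing
    field
      image : ∀ j → (M ·v P j) ≈v (scale m j • P (perm m j))

  syndrome-apply : ∀ {r N} {P : Fin N → V r} {M m} → Represents P M m →
    ∀ x → syndrome P (apply m x) ≈v (M ·v syndrome P x)
  syndrome-apply {P = P} {M} {m} (representing MP≈) x c = begin
    sum (λ i → P i c * apply m x i)
      ≡⟨ sum-permute _ (perm m) (perm⁻¹ m) (perm∘perm⁻¹ m) (perm⁻¹∘perm m) ⟩
    sum (λ j → P (perm m j) c * (scale m (perm⁻¹ m (perm m j)) * x (perm⁻¹ m (perm m j))))
      ≡⟨ sum-cong (λ j → cong (λ t → P (perm m j) c * (scale m t * x t)) (perm⁻¹∘perm m j)) ⟩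
    sum (λ j → P (perm m j) c * (scale m j * x j))
      ≡⟨ sum-cong (λ j → trans (sym (*-assoc _ _ _)) (cong (_* x j) (trans (*-comm _ _) (sym (MP≈ j c))))) ⟩
    sum (λ j → (M ·v P j) c * x j)
      ≡⟨ sym (·v-syndrome M P x c) ⟩
    (M ·v syndrome P x) c ∎

  Represents-cong : ∀ {r N} {P : Fin N → V r} {M M′ m} → M ≈m M′ → Represents P M m → Represents P M′ m
  Represents-cong M≈M′ (representing MP≈) =
    representing λ j i → trans (·v-cong (≈m-sym M≈M′) (λ _ → refl) i) (MP≈ j i)

  Represents-idM : ∀ {r N} (P : Fin N → V r) → Represents P idM idₘ
  Represents-idM P = representing λ j i → trans (idM-·v (P j) i) (sym (*-identityˡ _))

  Represents-∘ₘ : ∀ {r N} {P : Fin N → V r} {M₁ M₂ m₁ m₂} → Represents P M₁ m₁ → Represents P M₂ m₂ →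
    Represents P (M₁ ·m M₂) (m₁ ∘ₘ m₂)
  Represents-∘ₘ {P = P} {M₁} {M₂} {m₁} {m₂} (representing M₁P≈) (representing M₂P≈) = representing λ j i →
    let μ₂ = scale m₂ j ; j₂ = perm m₂ j in begin
    ((M₁ ·m M₂) ·v P j) i                  ≡⟨ ·m-·v M₁ M₂ (P j) i ⟩
    (M₁ ·v (M₂ ·v P j)) i                  ≡⟨ ·v-congʳ M₁ (M₂P≈ j) i ⟩
    (M₁ ·v (μ₂ • P j₂)) i                  ≡⟨ ·v-• M₁ μ₂ (P j₂) i ⟩
    μ₂ * (M₁ ·v P j₂) i                    ≡⟨ cong (μ₂ *_) (M₁P≈ j₂ i) ⟩
    μ₂ * (scale m₁ j₂ * P (perm m₁ j₂) i)  ≡⟨ sym (*-assoc _ _ _) ⟩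
    (μ₂ * scale m₁ j₂) * P (perm m₁ j₂) i  ∎

  module _ {r n} {H : Fin n → V r} (hamming : IsHammingPCM H) where

    private
      column-image : ∀ {M M′} → (M′ ·m M) ≈m idM → ∀ j → ∃[ k ] ∃[ λ′ ] ((M ·v H j) ≈v (λ′ • H k))
      column-image {M} {M′} M′M≈I j = proj₂ (proj₂ hamming) (M ·v H j) MHj≉0
        where
        MHj≉0 : ¬ ((M ·v H j) ≈v 0v)
        MHj≉0 MHj≈0 = proj₁ hamming j (λ i →
          trans (sym (leftInverse-·v M′M≈I (H j) i)) (trans (·v-congʳ M′ MHj≈0 i) (·v-0v M′ i)))

      column-image-scale≢0 : ∀ {M M′} (M′M≈I : (M′ ·m M) ≈m idM) j → proj₁ (proj₂ (column-image M′M≈I j)) ≢ 0#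
      column-image-scale≢0 {M} {M′} M′M≈I j λ≡0 = proj₁ hamming j (λ i → begin
        H j i                    ≡⟨ sym (leftInverse-·v M′M≈I (H j) i) ⟩
        (M′ ·v (M ·v H j)) i     ≡⟨ ·v-congʳ M′ (λ i → trans (proj₂ (proj₂ (column-image M′M≈I j)) i)
                                                              (trans (cong (_* H (proj₁ (column-image M′M≈I j)) i) λ≡0) (zeroˡ _))) i ⟩
        (M′ ·v 0v) i             ≡⟨ ·v-0v M′ i ⟩
        0#                       ∎)

      column-image-round-trip : ∀ {M M′} (M′M≈I : (M′ ·m M) ≈m idM) (MM′≈I : (M ·m M′) ≈m idM) j →
        proj₁ (column-image MM′≈I (proj₁ (column-image M′M≈I j))) ≡ j
      column-image-round-trip {M} {M′} M′M≈I MM′≈I j with column-image M′M≈I j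
      ... | k , λ′ , MHj≈λ′Hk with column-image MM′≈I k
      ...   | k′ , λ″ , M′Hk≈λ″Hk′ = sym (proj₁ (•-column-injective hamming 1≢0 Hj≈λ′λ″Hk′))
        where
        Hj≈λ′λ″Hk′ : (1# • H j) ≈v ((λ′ * λ″) • H k′)
        Hj≈λ′λ″Hk′ i = begin
          1# * H j i                  ≡⟨ *-identityˡ _ ⟩
          H j i                       ≡⟨ sym (leftInverse-·v M′M≈I (H j) i) ⟩
          (M′ ·v (M ·v H j)) i        ≡⟨ ·v-congʳ M′ MHj≈λ′Hk i ⟩
          (M′ ·v (λ′ • H k)) i        ≡⟨ ·v-• M′ λ′ (H k) i ⟩
          λ′ * (M′ ·v H k) i          ≡⟨ cong (λ′ *_) (M′Hk≈λ″Hk′ i) ⟩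
          λ′ * (λ″ * H k′ i)          ≡⟨ sym (*-assoc _ _ _) ⟩
          (λ′ * λ″) * H k′ i          ∎

    hamming-monomial : ∀ {M} → IsGL M → Σ[ m ∈ Monomial n ] Represents H M m
    hamming-monomial {M} (M′ , MM′≈I , M′M≈I) = m , representing (λ j → proj₂ (proj₂ (column-image M′M≈I j)))
      where
      m : Monomial n
      m = record
        { perm        = λ j → proj₁ (column-image M′M≈I j)
        ; perm⁻¹      = λ i → proj₁ (column-image MM′≈I i)
        ; perm∘perm⁻¹ = column-image-round-trip MM′≈I M′M≈I
        ; perm⁻¹∘perm = column-image-round-trip M′M≈I MM′≈I
        ; scale       = λ j → proj₁ (proj₂ (column-image M′M≈I j))
        ; scale≢0     = column-image-scale≢0 M′M≈I
        }

    hamming-represents-unique : ∀ {M m m′} → Represents H M m → Represents H M m′ →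
      ∀ x → apply m x ≈w apply m′ x
    hamming-represents-unique {m = m} {m′} (representing MH≈) (representing MH≈′) =
      apply-cong-monomial m m′ (λ j → proj₁ (same j)) (λ j → proj₂ (same j))
      where
      same : ∀ j → (perm m j ≡ perm m′ j) × (scale m j ≡ scale m′ j)
      same j = •-column-injective hamming (scale≢0 m j) (λ i → trans (sym (MH≈ j i)) (MH≈′ j i))

    hamming-∘ₘ-identity : ∀ {M M′ m m′} → Represents H M m → Represents H M′ m′ → (M′ ·m M) ≈m idM →
      ∀ x → apply (m′ ∘ₘ m) x ≈w x
    hamming-∘ₘ-identity {M} {M′} {m} {m′} MH≈ M′H≈ M′M≈I x i =
      trans (hamming-represents-unique {m = m′ ∘ₘ m} {idₘ} M′M≈ (Represents-idM H) x i)
            (apply-idₘ x i)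
      where
      M′M≈ : Represents H idM (m′ ∘ₘ m)
      M′M≈ = Represents-cong M′M≈I (Represents-∘ₘ M′H≈ MH≈)

  module _ {r} (ι : Indexing r) where

    private
      position-image : Matrix r → Fin (q ^ r) → Fin (q ^ r)
      position-image N k = proj₁ (surj ι (N ·v pos ι k))

      position-image-spec : ∀ N k → pos ι (position-image N k) ≈v (N ·v pos ι k)
      position-image-spec N k = proj₂ (surj ι (N ·v pos ι k))

      position-image-round-trip : ∀ {N N′} → (N′ ·m N) ≈m idM → ∀ k →
        position-image N′ (position-image N k) ≡ k
      position-image-round-trip {N} {N′} N′N≈I k = inj ι _ k (λ i → begin
        pos ι (position-image N′ (position-image N k)) i   ≡⟨ position-image-spec N′ _ i ⟩
        (N′ ·v pos ι (position-image N k)) i               ≡⟨ ·v-congʳ N′ (position-image-spec N k) i ⟩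
        (N′ ·v (N ·v pos ι k)) i                           ≡⟨ leftInverse-·v N′N≈I (pos ι k) i ⟩
        pos ι k i                                          ∎)

    position-monomial : ∀ {N} → IsGL N → Σ[ m ∈ Monomial (q ^ r) ] (Represents (pos ι) N m × UnitScaled m)
    position-monomial {N} (N′ , NN′≈I , N′N≈I) =
      m , representing (λ k i → trans (sym (position-image-spec N k i)) (sym (*-identityˡ _))) , (λ _ → refl)
      where
      m : Monomial (q ^ r)
      m = record
        { perm        = position-image N
        ; perm⁻¹      = position-image N′
        ; perm∘perm⁻¹ = position-image-round-trip NN′≈I
        ; perm⁻¹∘perm = position-image-round-trip N′N≈I
        ; scale       = λ _ → 1#
        ; scale≢0     = λ _ → 1≢0
        }

    position-represents-unique : ∀ {N m m′} → Represents (pos ι) N m → Represents (pos ι) N m′ →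
      UnitScaled m → UnitScaled m′ → ∀ x → apply m x ≈w apply m′ x
    position-represents-unique {m = m} {m′} (representing NP≈) (representing NP≈′) unit unit′ =
      apply-cong-monomial m m′ same-perm (λ j → trans (unit j) (sym (unit′ j)))
      where
      same-perm : ∀ j → perm m j ≡ perm m′ j
      same-perm j = inj ι _ _ (λ i → begin
        pos ι (perm m j) i                  ≡⟨ sym (*-identityˡ _) ⟩
        1# * pos ι (perm m j) i             ≡⟨ cong (_* _) (sym (unit j)) ⟩
        scale m j * pos ι (perm m j) i      ≡⟨ trans (sym (NP≈ j i)) (NP≈′ j i) ⟩
        scale m′ j * pos ι (perm m′ j) i    ≡⟨ cong (_* _) (unit′ j) ⟩
        1# * pos ι (perm m′ j) i            ≡⟨ *-identityˡ _ ⟩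
        pos ι (perm m′ j) i                 ∎)

    position-∘ₘ-identity : ∀ {N N′ m m′} → Represents (pos ι) N m → Represents (pos ι) N′ m′ →
      UnitScaled m → UnitScaled m′ → (N′ ·m N) ≈m idM → ∀ y → apply (m′ ∘ₘ m) y ≈w y
    position-∘ₘ-identity {N} {N′} {m} {m′} NP≈ N′P≈ unit unit′ N′N≈I y i =
      trans (position-represents-unique {m = m′ ∘ₘ m} {idₘ} N′N≈ (Represents-idM (pos ι))
                                         (∘ₘ-unitScaled m′ m unit′ unit) (λ _ → refl) y i)
            (apply-idₘ y i)
      where
      N′N≈ : Represents (pos ι) idM (m′ ∘ₘ m)
      N′N≈ = Represents-cong N′N≈I (Represents-∘ₘ N′P≈ NP≈)

  module ExtendedCode {r n} (H : Fin n → V r) (ι : Indexing r) (τ : V r → V r)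
                      (τ-cong : ∀ a b → a ≈v b → τ a ≈v τ b) where

    Q : ℕ
    Q = q ^ r

    left : Word (n ℕ.+ Q) → Word n
    left = take n

    right : Word (n ℕ.+ Q) → Word Q
    right = drop n

    syndromeˡ : Word (n ℕ.+ Q) → V r
    syndromeˡ z = syndrome H (left z)

    parity : Word (n ℕ.+ Q) → Carrier
    parity z = sum (right z)

    syndromeʳ : Word (n ℕ.+ Q) → V r
    syndromeʳ z = syndrome (pos ι) (right z)

    Checks : Word (n ℕ.+ Q) → Set
    Checks z = (parity z ≡ 0#) × (syndromeʳ z ≈v negv (τ (syndromeˡ z)))

    S⇒checks : ∀ {z} → S H ι τ z → Checks z
    S⇒checks {z} (a , x , y , Hx≈a , y∈Dτa , z≈x++y) =
      trans (sum-cong right≈y) Σy≡0 ,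
      λ i → trans (syndrome-congʳ (pos ι) right≈y i) (trans (Py≈-τa i) (cong -_ (τ-cong a (syndromeˡ z) a≈Hleft i)))
      where
      right≈y : right z ≈w y
      right≈y k = trans (z≈x++y (n ↑ʳ k)) (lookup-++ʳ x y k)
      a≈Hleft : a ≈v syndromeˡ z
      a≈Hleft i = sym (trans (syndrome-congʳ H (λ j → trans (z≈x++y (j ↑ˡ Q)) (lookup-++ˡ x y j)) i) (Hx≈a i))
      Σy≡0 : sum y ≡ 0#
      Σy≡0 = proj₁ (Da⇒checks ι y∈Dτa)
      Py≈-τa : syndrome (pos ι) y ≈v negv (τ a)
      Py≈-τa = proj₂ (Da⇒checks ι y∈Dτa)

    checks⇒S : ∀ {z} → Checks z → S H ι τ z
    checks⇒S {z} (parity≡0 , syndromeʳ≈-τsyndromeˡ) =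
      syndromeˡ z , left z , right z , (λ _ → refl) , checks⇒Da ι parity≡0 syndromeʳ≈-τsyndromeˡ ,
      take++drop n z

    S-cong : ∀ {c c′} → c ≈w c′ → S H ι τ c → S H ι τ c′
    S-cong c≈c′ (a , x , y , Hx≈a , y∈D , c≈x++y) = a , x , y , Hx≈a , y∈D , λ i → trans (sym (c≈c′ i)) (c≈x++y i)

    syndromeˡ-cong : ∀ {z z′} → z ≈w z′ → syndromeˡ z ≈v syndromeˡ z′
    syndromeˡ-cong z≈z′ = syndrome-congʳ H (λ j → z≈z′ (j ↑ˡ Q))

    parity-cong : ∀ {z z′} → z ≈w z′ → parity z ≡ parity z′
    parity-cong z≈z′ = sum-cong (λ k → z≈z′ (n ↑ʳ k))

    syndromeʳ-cong : ∀ {z z′} → z ≈w z′ → syndromeʳ z ≈v syndromeʳ z′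
    syndromeʳ-cong z≈z′ = syndrome-congʳ (pos ι) (λ k → z≈z′ (n ↑ʳ k))

    module _ (z : Word (n ℕ.+ Q)) (δ : Carrier) where

      private
        right-unchanged : ∀ j → right (z [ j ↑ˡ Q ]+= δ) ≈w right z
        right-unchanged j k = trans (cong (right z k +_) (unit-↑ˡ-↑ʳ j k δ)) (+-identityʳ _)

        left-unchanged : ∀ k → left (z [ n ↑ʳ k ]+= δ) ≈w left z
        left-unchanged k j = trans (cong (left z j +_) (unit-↑ʳ-↑ˡ j k δ)) (+-identityʳ _)

      syndromeˡ-[↑ˡ]+= : ∀ j → syndromeˡ (z [ j ↑ˡ Q ]+= δ) ≈v (syndromeˡ z +v (δ • H j))
      syndromeˡ-[↑ˡ]+= j i =
        trans (syndrome-congʳ H (λ j′ → cong (left z j′ +_) (unit-↑ˡ j j′ δ)) i)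
              (trans (syndrome-+ H (left z) (unit j δ) i) (cong (syndromeˡ z i +_) (syndrome-unit H j δ i)))

      parity-[↑ˡ]+= : ∀ j → parity (z [ j ↑ˡ Q ]+= δ) ≡ parity z
      parity-[↑ˡ]+= j = sum-cong (right-unchanged j)

      syndromeʳ-[↑ˡ]+= : ∀ j → syndromeʳ (z [ j ↑ˡ Q ]+= δ) ≈v syndromeʳ z
      syndromeʳ-[↑ˡ]+= j = syndrome-congʳ (pos ι) (right-unchanged j)

      syndromeˡ-[↑ʳ]+= : ∀ k → syndromeˡ (z [ n ↑ʳ k ]+= δ) ≈v syndromeˡ z
      syndromeˡ-[↑ʳ]+= k = syndrome-congʳ H (left-unchanged k)

      parity-[↑ʳ]+= : ∀ k → parity (z [ n ↑ʳ k ]+= δ) ≡ parity z + δ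
      parity-[↑ʳ]+= k =
        trans (sum-cong (λ k′ → cong (right z k′ +_) (unit-↑ʳ {n} k k′ δ)))
              (trans (sum-distrib-+ (right z) (unit k δ)) (cong (parity z +_) (sum-unit k δ)))

      syndromeʳ-[↑ʳ]+= : ∀ k → syndromeʳ (z [ n ↑ʳ k ]+= δ) ≈v (syndromeʳ z +v (δ • pos ι k))
      syndromeʳ-[↑ʳ]+= k i =
        trans (syndrome-congʳ (pos ι) (λ k′ → cong (right z k′ +_) (unit-↑ʳ {n} k k′ δ)) i)
              (trans (syndrome-+ (pos ι) (right z) (unit k δ) i)
                     (cong (syndromeʳ z i +_) (syndrome-unit (pos ι) k δ i)))

    module Perfect (hamming : IsHammingPCM H)
                   (τ-injective : ∀ a b → τ a ≈v τ b → a ≈v b)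
                   (τ-surjective : ∀ t → ∃[ a ] (τ a ≈v t))
                   (j₀ : Fin n) where

      Within1 : Word (n ℕ.+ Q) → Word (n ℕ.+ Q) → Set
      Within1 z c = S H ι τ c × dist z c ≤ 1

      -- A nonzero parity s is corrected by −s at the position k with s · k = syndromeʳ z + τ (syndromeˡ z).
      cover-by-right : ∀ z → parity z ≢ 0# → ∃[ c ] Within1 z c
      cover-by-right z s≢0 with inverse (parity z) s≢0
      ... | s⁻¹ , ss⁻¹≡1 with surj ι (s⁻¹ • (syndromeʳ z +v τ (syndromeˡ z)))
      ... | k , pk≈p = c , checks⇒S (parity-c≡0 , syndromeʳ-c) , dist-[]+= z (n ↑ʳ k) (- s)
        where
        s : Carrier
        s = parity z
        b t : V r
        b = syndromeʳ z
        t = τ (syndromeˡ z)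
        c : Word (n ℕ.+ Q)
        c = z [ n ↑ʳ k ]+= - s
        parity-c≡0 : parity c ≡ 0#
        parity-c≡0 = trans (parity-[↑ʳ]+= z (- s) k) (-‿inverseʳ s)
        syndromeʳ-c : syndromeʳ c ≈v negv (τ (syndromeˡ c))
        syndromeʳ-c i = begin
          syndromeʳ c i                     ≡⟨ syndromeʳ-[↑ʳ]+= z (- s) k i ⟩
          b i + - s * pos ι k i             ≡⟨ cong (λ u → b i + - s * u) (pk≈p i) ⟩
          b i + - s * (s⁻¹ * (b i + t i))   ≡⟨ cong (b i +_) (sym (-‿distribˡ-* s _)) ⟩
          b i + - (s * (s⁻¹ * (b i + t i))) ≡⟨ cong (λ u → b i + - u) (sym (*-assoc s s⁻¹ _)) ⟩
          b i + - ((s * s⁻¹) * (b i + t i)) ≡⟨ cong (λ u → b i + - (u * (b i + t i))) ss⁻¹≡1 ⟩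
          b i + - (1# * (b i + t i))        ≡⟨ cong (λ u → b i + - u) (*-identityˡ _) ⟩
          b i + - (b i + t i)               ≡⟨ cong (b i +_) (sym (-‿+-comm (b i) (t i))) ⟩
          b i + (- b i + - t i)             ≡⟨ \\-leftDividesˡ (b i) (- t i) ⟩
          - t i                             ≡⟨ cong -_ (τ-cong _ _ (λ i → sym (syndromeˡ-[↑ʳ]+= z (- s) k i)) i) ⟩
          - τ (syndromeˡ c) i               ∎

      -- With zero parity the correction lies in the C-part: the required syndrome a* = τ⁻¹(−syndromeʳ z)
      -- differs from syndromeˡ z by a multiple of a column of H.
      cover-by-left : ∀ z → parity z ≡ 0# → ¬ Checks z → ∃[ c ] Within1 z c
      cover-by-left z s≡0 ¬checks with τ-surjective (negv (syndromeʳ z))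
      ... | a* , τa*≈-b with proj₂ (proj₂ hamming) v v≉0
        where
        v : V r
        v i = a* i + - syndromeˡ z i
        v≉0 : ¬ (v ≈v 0v)
        v≉0 v≈0 = ¬checks (s≡0 , λ i → trans (sym (-‿involutive _))
          (cong -_ (trans (sym (τa*≈-b i)) (τ-cong a* (syndromeˡ z) (λ i → x∙y⁻¹≈ε⇒x≈y _ _ (v≈0 i)) i))))
      ... | j , λ′ , v≈λ′Hj = c , checks⇒S (parity-c≡0 , syndromeʳ-c) , dist-[]+= z (j ↑ˡ Q) λ′
        where
        c : Word (n ℕ.+ Q)
        c = z [ j ↑ˡ Q ]+= λ′
        syndromeˡ-c : syndromeˡ c ≈v a*
        syndromeˡ-c i = trans (syndromeˡ-[↑ˡ]+= z λ′ j i)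
                              (trans (cong (syndromeˡ z i +_) (sym (v≈λ′Hj i))) (x+[y-x]≡y _ _))
        parity-c≡0 : parity c ≡ 0#
        parity-c≡0 = trans (parity-[↑ˡ]+= z λ′ j) s≡0
        syndromeʳ-c : syndromeʳ c ≈v negv (τ (syndromeˡ c))
        syndromeʳ-c i = begin
          syndromeʳ c i            ≡⟨ syndromeʳ-[↑ˡ]+= z λ′ j i ⟩
          syndromeʳ z i            ≡⟨ sym (-‿involutive _) ⟩
          - - syndromeʳ z i        ≡⟨ cong -_ (sym (τa*≈-b i)) ⟩
          - τ a* i                 ≡⟨ cong -_ (τ-cong _ _ (λ i → sym (syndromeˡ-c i)) i) ⟩
          - τ (syndromeˡ c) i      ∎

      covering : ∀ z → ∃[ c ] Within1 z c
      covering z with parity z ≟ 0#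
      ... | no s≢0 = cover-by-right z s≢0
      ... | yes s≡0 with syndromeʳ z ≟v negv (τ (syndromeˡ z))
      ...   | yes b≈-τa = z , checks⇒S (s≡0 , b≈-τa) , ℕ.≤-trans (ℕ.≤-reflexive (dist-refl z)) z≤n
      ...   | no b≉-τa  = cover-by-left z s≡0 (b≉-τa ∘′ proj₂)

      LeftCorrection : Word (n ℕ.+ Q) → Word (n ℕ.+ Q) → Set
      LeftCorrection z c = ∃[ j ] ∃[ δ ] (c ≈w (z [ j ↑ˡ Q ]+= δ))

      RightCorrection : Word (n ℕ.+ Q) → Word (n ℕ.+ Q) → Set
      RightCorrection z c = ∃[ k ] ∃[ δ ] (δ ≢ 0# × c ≈w (z [ n ↑ʳ k ]+= δ))

      correction-dichotomy : ∀ z c → dist z c ≤ 1 → LeftCorrection z c ⊎ RightCorrection z c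
      correction-dichotomy z c d≤1 with dist≤1⇒[]+= (j₀ ↑ˡ Q) z c d≤1
      ... | i , δ , c≈z+δ with splitAt-view n Q i
      ...   | inj₁ (j , refl) = inj₁ (j , δ , c≈z+δ)
      ...   | inj₂ (k , refl) with δ ≟ 0#
      ...     | no δ≢0  = inj₂ (k , δ , δ≢0 , c≈z+δ)
      ...     | yes refl = inj₁ (j₀ , 0# , λ m → trans (c≈z+δ m)
                              (cong (z m +_) (trans (unit-zero _ m) (sym (unit-zero _ m)))))

      left-correction⇒parity≡0 : ∀ {z c} → S H ι τ c → LeftCorrection z c → parity z ≡ 0#
      left-correction⇒parity≡0 {z} c∈S (j , δ , c≈z+δ) =
        trans (sym (parity-[↑ˡ]+= z δ j)) (trans (sym (parity-cong c≈z+δ)) (proj₁ (S⇒checks c∈S)))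

      right-correction⇒parity≢0 : ∀ {z c} → S H ι τ c → RightCorrection z c → parity z ≢ 0#
      right-correction⇒parity≢0 {z} {c} c∈S (k , δ , δ≢0 , c≈z+δ) s≡0 = δ≢0 (begin
        δ                   ≡⟨ sym (+-identityˡ δ) ⟩
        0# + δ              ≡⟨ cong (_+ δ) (sym s≡0) ⟩
        parity z + δ        ≡⟨ sym (parity-[↑ʳ]+= z δ k) ⟩
        parity (z [ n ↑ʳ k ]+= δ) ≡⟨ sym (parity-cong c≈z+δ) ⟩
        parity c            ≡⟨ proj₁ (S⇒checks c∈S) ⟩
        0#                  ∎)

      τ-syndromeˡ : ∀ {c} → S H ι τ c → τ (syndromeˡ c) ≈v negv (syndromeʳ c)
      τ-syndromeˡ c∈S i = trans (sym (-‿involutive _)) (cong -_ (sym (proj₂ (S⇒checks c∈S) i)))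

      left-correction-unique : ∀ {z c c′} → S H ι τ c → S H ι τ c′ →
        LeftCorrection z c → LeftCorrection z c′ → c ≈w c′
      left-correction-unique {z} {c} {c′} c∈S c′∈S (j , δ , c≈z+δ) (j′ , δ′ , c′≈z+δ′) m =
        trans (c≈z+δ m) (trans (cong (z m +_) (unit-↑ˡ-cong unit≈unit m)) (sym (c′≈z+δ′ m)))
        where
        Ac≈Ac′ : syndromeˡ c ≈v syndromeˡ c′
        Ac≈Ac′ = τ-injective _ _ λ i → begin
          τ (syndromeˡ c) i      ≡⟨ τ-syndromeˡ c∈S i ⟩
          - syndromeʳ c i        ≡⟨ cong -_ (trans (syndromeʳ-cong c≈z+δ i) (syndromeʳ-[↑ˡ]+= z δ j i)) ⟩
          - syndromeʳ z i        ≡⟨ cong -_ (sym (trans (syndromeʳ-cong c′≈z+δ′ i) (syndromeʳ-[↑ˡ]+= z δ′ j′ i))) ⟩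
          - syndromeʳ c′ i       ≡⟨ sym (τ-syndromeˡ c′∈S i) ⟩
          τ (syndromeˡ c′) i     ∎
        δHj≈δ′Hj′ : (δ • H j) ≈v (δ′ • H j′)
        δHj≈δ′Hj′ i = +-cancelˡ (syndromeˡ z i) _ _ (begin
          syndromeˡ z i + δ * H j i     ≡⟨ sym (trans (syndromeˡ-cong c≈z+δ i) (syndromeˡ-[↑ˡ]+= z δ j i)) ⟩
          syndromeˡ c i                 ≡⟨ Ac≈Ac′ i ⟩
          syndromeˡ c′ i                ≡⟨ trans (syndromeˡ-cong c′≈z+δ′ i) (syndromeˡ-[↑ˡ]+= z δ′ j′ i) ⟩
          syndromeˡ z i + δ′ * H j′ i   ∎)
        unit≈unit : unit j δ ≈w unit j′ δ′
        unit≈unit = unit-syndrome-injective hamming j j′ δ δ′ δHj≈δ′Hj′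

      right-correction-unique : ∀ {z c c′} → S H ι τ c → S H ι τ c′ →
        RightCorrection z c → RightCorrection z c′ → c ≈w c′
      right-correction-unique {z} {c} {c′} c∈S c′∈S (k , δ , δ≢0 , c≈z+δ) (k′ , δ′ , _ , c′≈z+δ′) m =
        trans (c≈z+δ m) (trans (cong₂ (λ a u → z m + unit (n ↑ʳ a) u m) k≡k′ δ≡δ′) (sym (c′≈z+δ′ m)))
        where
        δ≡-s : ∀ {k δ c} → S H ι τ c → c ≈w (z [ n ↑ʳ k ]+= δ) → δ ≡ - parity z
        δ≡-s {k} {δ} c∈S c≈z+δ =
          +-inverseʳ-unique (parity z) δ (trans (sym (parity-[↑ʳ]+= z δ k))
                                                (trans (sym (parity-cong c≈z+δ)) (proj₁ (S⇒checks c∈S))))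
        δ≡δ′ : δ ≡ δ′
        δ≡δ′ = trans (δ≡-s c∈S c≈z+δ) (sym (δ≡-s c′∈S c′≈z+δ′))
        Bc≈Bc′ : syndromeʳ c ≈v syndromeʳ c′
        Bc≈Bc′ i = begin
          syndromeʳ c i            ≡⟨ proj₂ (S⇒checks c∈S) i ⟩
          - τ (syndromeˡ c) i      ≡⟨ cong -_ (τ-cong _ _ Ac≈Ac′ i) ⟩
          - τ (syndromeˡ c′) i     ≡⟨ sym (proj₂ (S⇒checks c′∈S) i) ⟩
          syndromeʳ c′ i           ∎
          where
          Ac≈Ac′ : syndromeˡ c ≈v syndromeˡ c′
          Ac≈Ac′ i = trans (trans (syndromeˡ-cong c≈z+δ i) (syndromeˡ-[↑ʳ]+= z δ k i))
                           (sym (trans (syndromeˡ-cong c′≈z+δ′ i) (syndromeˡ-[↑ʳ]+= z δ′ k′ i)))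
        δpk≈δpk′ : ∀ i → δ * pos ι k i ≡ δ * pos ι k′ i
        δpk≈δpk′ i = +-cancelˡ (syndromeʳ z i) _ _ (begin
          syndromeʳ z i + δ * pos ι k i     ≡⟨ sym (trans (syndromeʳ-cong c≈z+δ i) (syndromeʳ-[↑ʳ]+= z δ k i)) ⟩
          syndromeʳ c i                     ≡⟨ Bc≈Bc′ i ⟩
          syndromeʳ c′ i                    ≡⟨ trans (syndromeʳ-cong c′≈z+δ′ i) (syndromeʳ-[↑ʳ]+= z δ′ k′ i) ⟩
          syndromeʳ z i + δ′ * pos ι k′ i   ≡⟨ cong (λ u → syndromeʳ z i + u * pos ι k′ i) (sym δ≡δ′) ⟩
          syndromeʳ z i + δ * pos ι k′ i    ∎)
        k≡k′ : k ≡ k′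
        k≡k′ = inj ι k k′ (λ i → *-almostCancelˡ δ _ _ δ≢0 (δpk≈δpk′ i))

      codewords-within1-unique : ∀ z c c′ → Within1 z c → Within1 z c′ → c ≈w c′
      codewords-within1-unique z c c′ (c∈S , d≤1) (c′∈S , d′≤1)
        with correction-dichotomy z c d≤1 | correction-dichotomy z c′ d′≤1
      ... | inj₁ L | inj₁ L′ = left-correction-unique c∈S c′∈S L L′
      ... | inj₂ R | inj₂ R′ = right-correction-unique c∈S c′∈S R R′
      ... | inj₁ L | inj₂ R′ = ⊥-elim (right-correction⇒parity≢0 c′∈S R′ (left-correction⇒parity≡0 c∈S L))
      ... | inj₂ R | inj₁ L′ = ⊥-elim (right-correction⇒parity≢0 c∈S R (left-correction⇒parity≡0 c′∈S L′))

      perfect : IsPerfect (S H ι τ)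
      perfect z = covering z , λ c c′ c∈S c′∈S d≤1 d′≤1 → codewords-within1-unique z c c′ (c∈S , d≤1) (c′∈S , d′≤1)

    record Transform : Set where
      constructor transform
      field
        mˡ : Monomial n
        u  : Word n
        mʳ : Monomial Q
        w  : Word Q

    open Transform

    ⟦_⟧ : Transform → Word (n ℕ.+ Q) → Word (n ℕ.+ Q)
    ⟦ t ⟧ z = (λ j → apply (mˡ t) (left z) j + u t j) ++ (λ k → apply (mʳ t) (right z) k + w t k)

    left-⟦⟧ : ∀ t z → left (⟦ t ⟧ z) ≈w (λ j → apply (mˡ t) (left z) j + u t j)
    left-⟦⟧ t z = lookup-++ˡ (λ j → apply (mˡ t) (left z) j + u t j) _

    right-⟦⟧ : ∀ t z → right (⟦ t ⟧ z) ≈w (λ k → apply (mʳ t) (right z) k + w t k)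
    right-⟦⟧ t z = lookup-++ʳ (λ j → apply (mˡ t) (left z) j + u t j) _

    ⟦⟧-cong : ∀ t {z z′} → z ≈w z′ → ⟦ t ⟧ z ≈w ⟦ t ⟧ z′
    ⟦⟧-cong t z≈z′ = ++-cong _ _ (λ j → cong (_+ u t j) (apply-cong (mˡ t) (λ j → z≈z′ (j ↑ˡ Q)) j))
                                 (λ k → cong (_+ w t k) (apply-cong (mʳ t) (λ k → z≈z′ (n ↑ʳ k)) k))

    ⟦⟧-cong-parts : ∀ t t′ → (∀ x → apply (mˡ t) x ≈w apply (mˡ t′) x) → u t ≈w u t′ →
      (∀ y → apply (mʳ t) y ≈w apply (mʳ t′) y) → w t ≈w w t′ → ∀ z → ⟦ t ⟧ z ≈w ⟦ t′ ⟧ z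
    ⟦⟧-cong-parts t t′ mˡ≈ u≈ mʳ≈ w≈ z =
      ++-cong _ _ (λ j → cong₂ _+_ (mˡ≈ (left z) j) (u≈ j)) (λ k → cong₂ _+_ (mʳ≈ (right z) k) (w≈ k))

    ⟦⟧-identity : ∀ t → (∀ x → apply (mˡ t) x ≈w x) → (∀ j → u t j ≡ 0#) →
      (∀ y → apply (mʳ t) y ≈w y) → (∀ k → w t k ≡ 0#) → ∀ z → ⟦ t ⟧ z ≈w z
    ⟦⟧-identity t mˡ≈id u≡0 mʳ≈id w≡0 z i =
      trans (++-cong _ _ (λ j → trans (cong₂ _+_ (mˡ≈id (left z) j) (u≡0 j)) (+-identityʳ _))
                         (λ k → trans (cong₂ _+_ (mʳ≈id (right z) k) (w≡0 k)) (+-identityʳ _)) i)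
            (sym (take++drop n z i))

    dist-⟦⟧ : ∀ t z z′ → dist (⟦ t ⟧ z) (⟦ t ⟧ z′) ≡ dist z z′
    dist-⟦⟧ t z z′ = begin
      dist (⟦ t ⟧ z) (⟦ t ⟧ z′)
        ≡⟨ dist-++ (λ j → apply (mˡ t) (left z) j + u t j) (λ j → apply (mˡ t) (left z′) j + u t j) _ _ ⟩
      dist (λ j → apply (mˡ t) (left z) j + u t j) (λ j → apply (mˡ t) (left z′) j + u t j) ℕ.+
      dist (λ k → apply (mʳ t) (right z) k + w t k) (λ k → apply (mʳ t) (right z′) k + w t k)
        ≡⟨ cong₂ ℕ._+_ (dist-apply-+ (mˡ t) (u t) (left z) (left z′)) (dist-apply-+ (mʳ t) (w t) (right z) (right z′)) ⟩
      dist (left z) (left z′) ℕ.+ dist (right z) (right z′)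
        ≡⟨ sym (dist-++ (left z) (left z′) (right z) (right z′)) ⟩
      dist (left z ++ right z) (left z′ ++ right z′)
        ≡⟨ sym (dist-cong (take++drop n z) (take++drop n z′)) ⟩
      dist z z′ ∎

    infixr 9 _∘ₜ_
    _∘ₜ_ : Transform → Transform → Transform
    t₁ ∘ₜ t₂ = transform (mˡ t₁ ∘ₘ mˡ t₂) (λ j → apply (mˡ t₁) (u t₂) j + u t₁ j)
                         (mʳ t₁ ∘ₘ mʳ t₂) (λ k → apply (mʳ t₁) (w t₂) k + w t₁ k)

    ⟦⟧-∘ₜ : ∀ t₁ t₂ z → ⟦ t₁ ⟧ (⟦ t₂ ⟧ z) ≈w ⟦ t₁ ∘ₜ t₂ ⟧ z
    ⟦⟧-∘ₜ t₁ t₂ z = ++-cong _ _ (λ j → composed (mˡ t₁) (mˡ t₂) (u t₁) (u t₂) {x = left z} (left-⟦⟧ t₂ z) j)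
                                (λ k → composed (mʳ t₁) (mʳ t₂) (w t₁) (w t₂) {x = right z} (right-⟦⟧ t₂ z) k)
      where
      composed : ∀ {N} (m₁ m₂ : Monomial N) (v₁ v₂ : Word N) {x y : Word N} →
        y ≈w (λ i → apply m₂ x i + v₂ i) →
        ∀ i → apply m₁ y i + v₁ i ≡ apply (m₁ ∘ₘ m₂) x i + (apply m₁ v₂ i + v₁ i)
      composed m₁ m₂ v₁ v₂ {x} {y} y≈ i = begin
        apply m₁ y i + v₁ i                                        ≡⟨ cong (_+ v₁ i) (apply-cong m₁ y≈ i) ⟩
        apply m₁ (λ i → apply m₂ x i + v₂ i) i + v₁ i              ≡⟨ cong (_+ v₁ i) (apply-+ m₁ (apply m₂ x) v₂ i) ⟩
        (apply m₁ (apply m₂ x) i + apply m₁ v₂ i) + v₁ i           ≡⟨ +-assoc _ _ _ ⟩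
        apply m₁ (apply m₂ x) i + (apply m₁ v₂ i + v₁ i)           ≡⟨ cong (_+ (apply m₁ v₂ i + v₁ i)) (apply-∘ₘ m₁ m₂ x i) ⟩
        apply (m₁ ∘ₘ m₂) x i + (apply m₁ v₂ i + v₁ i)              ∎

    inverseₜ : Transform → Monomial n → Monomial Q → Transform
    inverseₜ t m′ˡ m′ʳ = transform m′ˡ (λ j → - apply m′ˡ (u t) j) m′ʳ (λ k → - apply m′ʳ (w t) k)

    ⟦⟧-inverseₜˡ : ∀ t m′ˡ m′ʳ → (∀ x → apply (m′ˡ ∘ₘ mˡ t) x ≈w x) → (∀ y → apply (m′ʳ ∘ₘ mʳ t) y ≈w y) →
      ∀ z → ⟦ inverseₜ t m′ˡ m′ʳ ⟧ (⟦ t ⟧ z) ≈w z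
    ⟦⟧-inverseₜˡ t m′ˡ m′ʳ m′ˡmˡ≈id m′ʳmʳ≈id z i =
      trans (⟦⟧-∘ₜ (inverseₜ t m′ˡ m′ʳ) t z i)
            (⟦⟧-identity (inverseₜ t m′ˡ m′ʳ ∘ₜ t) m′ˡmˡ≈id (λ j → -‿inverseʳ _) m′ʳmʳ≈id (λ k → -‿inverseʳ _) z i)

    ⟦⟧-inverseₜʳ : ∀ t m′ˡ m′ʳ → (∀ x → apply (mˡ t ∘ₘ m′ˡ) x ≈w x) → (∀ y → apply (mʳ t ∘ₘ m′ʳ) y ≈w y) →
      ∀ z → ⟦ t ⟧ (⟦ inverseₜ t m′ˡ m′ʳ ⟧ z) ≈w z
    ⟦⟧-inverseₜʳ t m′ˡ m′ʳ mˡm′ˡ≈id mʳm′ʳ≈id z i =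
      trans (⟦⟧-∘ₜ t (inverseₜ t m′ˡ m′ʳ) z i)
            (⟦⟧-identity (t ∘ₜ inverseₜ t m′ˡ m′ʳ) mˡm′ˡ≈id (cancels (mˡ t) m′ˡ (u t) mˡm′ˡ≈id)
                                                    mʳm′ʳ≈id (cancels (mʳ t) m′ʳ (w t) mʳm′ʳ≈id) z i)
      where
      cancels : ∀ {N} (m m′ : Monomial N) (v : Word N) → (∀ x → apply (m ∘ₘ m′) x ≈w x) →
        ∀ i → apply m (λ j → - apply m′ v j) i + v i ≡ 0#
      cancels m m′ v mm′≈id i = begin
        apply m (λ j → - apply m′ v j) i + v i   ≡⟨ cong (_+ v i) (apply-neg m (apply m′ v) i) ⟩
        - apply m (apply m′ v) i + v i           ≡⟨ cong (λ t → - t + v i) (trans (apply-∘ₘ m m′ v i) (mm′≈id v i)) ⟩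
        - v i + v i                              ≡⟨ -‿inverseˡ (v i) ⟩
        0#                                       ∎

    module Propelinear (hamming : IsHammingPCM H)
                       {G : Aff r → Set} (subgroup : IsSubgroupGA G) (regular : IsRegular G)
                       {T : Aff r → Aff r} (automorphism : IsAutomorphism G T)
                       (induced : IsInducedPerm G T τ) where

      private
        G-GL : ∀ g → G g → IsGL (lin g)
        G-GL = proj₁ (proj₂ subgroup)

        G-idA : G idA
        G-idA = proj₁ (proj₂ (proj₂ subgroup))

        G-∘A : ∀ g h → G g → G h → G (g ∘A h)
        G-∘A = proj₁ (proj₂ (proj₂ (proj₂ subgroup)))

        T-closed : ∀ g → G g → G (T g)
        T-closed = proj₁ automorphism

        T-hom : ∀ g h → G g → G h → T (g ∘A h) ≈A (T g ∘A T h)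
        T-hom = proj₁ (proj₂ (proj₂ automorphism))

        T-GL : ∀ g → G g → IsGL (lin (T g))
        T-GL g g∈G = G-GL (T g) (T-closed g g∈G)

        T-inverse : ∀ h h′ → G h → G h′ → (h ∘A h′) ≈A idA → (T h ∘A T h′) ≈A idA
        T-inverse h h′ h∈G h′∈G hh′≈id =
          ≈A-trans (≈A-sym (T-hom h h′ h∈G h′∈G))
            (≈A-trans (proj₁ (proj₂ automorphism) (h ∘A h′) idA (G-∘A h h′ h∈G h′∈G) G-idA hh′≈id)
                      (T-idA subgroup regular automorphism))

      -- g ∈ G together with the paper's isometry (x | y) ↦ (M x + u | N y + w) attached to it,
      -- M and N being monomial maps induced by lin g and lin (T g).
      record Element : Set where
        field
          g             : Aff r
          g∈G           : G g
          t             : Transform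
          mˡ-represents : Represents H (lin g) (mˡ t)
          mʳ-represents : Represents (pos ι) (lin (T g)) (mʳ t)
          mʳ-unitScaled : UnitScaled (mʳ t)
          u-syndrome    : syndrome H (u t) ≈v shift g
          w-sum         : sum (w t) ≡ 0#
          w-syndrome    : syndrome (pos ι) (w t) ≈v negv (shift (T g))

      open Element

      syndromeˡ-⟦⟧ : ∀ e z → syndromeˡ (⟦ t e ⟧ z) ≈v act (g e) (syndromeˡ z)
      syndromeˡ-⟦⟧ e z i = begin
        syndromeˡ (⟦ t e ⟧ z) i                                                ≡⟨ syndrome-congʳ H (left-⟦⟧ (t e) z) i ⟩
        syndrome H (λ j → apply (mˡ (t e)) (left z) j + u (t e) j) i           ≡⟨ syndrome-+ H (apply (mˡ (t e)) (left z)) (u (t e)) i ⟩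
        syndrome H (apply (mˡ (t e)) (left z)) i + syndrome H (u (t e)) i      ≡⟨ cong₂ _+_ (syndrome-apply (mˡ-represents e) (left z) i) (u-syndrome e i) ⟩
        (lin (g e) ·v syndromeˡ z) i + shift (g e) i                           ≡⟨ +-comm _ _ ⟩
        act (g e) (syndromeˡ z) i                                              ∎

      parity-⟦⟧ : ∀ e z → parity (⟦ t e ⟧ z) ≡ parity z
      parity-⟦⟧ e z = begin
        parity (⟦ t e ⟧ z)                                      ≡⟨ sum-cong (right-⟦⟧ (t e) z) ⟩
        sum (λ k → apply (mʳ (t e)) (right z) k + w (t e) k)    ≡⟨ sum-distrib-+ (apply (mʳ (t e)) (right z)) (w (t e)) ⟩
        sum (apply (mʳ (t e)) (right z)) + sum (w (t e))        ≡⟨ cong₂ _+_ (sum-apply (mʳ (t e)) (mʳ-unitScaled e) (right z)) (w-sum e) ⟩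
        parity z + 0#                                           ≡⟨ +-identityʳ _ ⟩
        parity z                                                ∎

      syndromeʳ-⟦⟧ : ∀ e z → syndromeʳ (⟦ t e ⟧ z) ≈v ((lin (T (g e)) ·v syndromeʳ z) +v negv (shift (T (g e))))
      syndromeʳ-⟦⟧ e z i = begin
        syndromeʳ (⟦ t e ⟧ z) i                                                    ≡⟨ syndrome-congʳ (pos ι) (right-⟦⟧ (t e) z) i ⟩
        syndrome (pos ι) (λ k → apply (mʳ (t e)) (right z) k + w (t e) k) i        ≡⟨ syndrome-+ (pos ι) (apply (mʳ (t e)) (right z)) (w (t e)) i ⟩
        syndrome (pos ι) (apply (mʳ (t e)) (right z)) i + syndrome (pos ι) (w (t e)) i
          ≡⟨ cong₂ _+_ (syndrome-apply (mʳ-represents e) (right z) i) (w-syndrome e i) ⟩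
        (lin (T (g e)) ·v syndromeʳ z) i + - shift (T (g e)) i                     ∎

      ⟦⟧-preserves-S : ∀ e {z} → S H ι τ z → S H ι τ (⟦ t e ⟧ z)
      ⟦⟧-preserves-S e {z} z∈S = checks⇒S (trans (parity-⟦⟧ e z) (proj₁ (S⇒checks z∈S)) , syndromeʳ-image)
        where
        N : Matrix r
        N = lin (T (g e))
        a : V r
        a = syndromeˡ z
        syndromeʳ-image : syndromeʳ (⟦ t e ⟧ z) ≈v negv (τ (syndromeˡ (⟦ t e ⟧ z)))
        syndromeʳ-image i = begin
          syndromeʳ (⟦ t e ⟧ z) i                       ≡⟨ syndromeʳ-⟦⟧ e z i ⟩
          (N ·v syndromeʳ z) i + - shift (T (g e)) i    ≡⟨ cong (_+ - shift (T (g e)) i) (·v-congʳ N (proj₂ (S⇒checks z∈S)) i) ⟩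
          (N ·v negv (τ a)) i + - shift (T (g e)) i     ≡⟨ cong (_+ - shift (T (g e)) i) (·v-negv N (τ a) i) ⟩
          - (N ·v τ a) i + - shift (T (g e)) i          ≡⟨ -‿+-comm _ _ ⟩
          - ((N ·v τ a) i + shift (T (g e)) i)          ≡⟨ cong -_ (+-comm _ _) ⟩
          - act (T (g e)) (τ a) i                       ≡⟨ cong -_ (sym (τ-equivariant subgroup regular automorphism induced (g e) (g∈G e) a i)) ⟩
          - τ (act (g e) a) i                           ≡⟨ cong -_ (τ-cong _ _ (λ i → sym (syndromeˡ-⟦⟧ e z i)) i) ⟩
          - τ (syndromeˡ (⟦ t e ⟧ z)) i                 ∎

      identity : Element
      identity = record
        { g = idA ; g∈G = G-idA
        ; t = transform idₘ (λ _ → 0#) idₘ (λ _ → 0#)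
        ; mˡ-represents = Represents-idM H
        ; mʳ-represents = Represents-cong (≈m-sym (proj₂ T-idA≈idA)) (Represents-idM (pos ι))
        ; mʳ-unitScaled = λ _ → refl
        ; u-syndrome = syndrome-zero H
        ; w-sum = sum-zero Q
        ; w-syndrome = λ i → trans (syndrome-zero (pos ι) i) (trans (sym -0#≈0#) (cong -_ (sym (proj₁ T-idA≈idA i))))
        }
        where
        T-idA≈idA : T idA ≈A idA
        T-idA≈idA = T-idA subgroup regular automorphism

      infixl 7 _·_
      _·_ : Element → Element → Element
      e₁ · e₂ = record
        { g = g₁ ∘A g₂ ; g∈G = G-∘A g₁ g₂ (g∈G e₁) (g∈G e₂)
        ; t = t e₁ ∘ₜ t e₂
        ; mˡ-represents = Represents-∘ₘ (mˡ-represents e₁) (mˡ-represents e₂)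
        ; mʳ-represents = Represents-cong (≈m-sym (proj₂ T-hom₁₂)) (Represents-∘ₘ (mʳ-represents e₁) (mʳ-represents e₂))
        ; mʳ-unitScaled = ∘ₘ-unitScaled (mʳ (t e₁)) (mʳ (t e₂)) (mʳ-unitScaled e₁) (mʳ-unitScaled e₂)
        ; u-syndrome = u-syndrome₁₂
        ; w-sum = trans (sum-distrib-+ (apply (mʳ (t e₁)) (w (t e₂))) (w (t e₁)))
                        (trans (cong₂ _+_ (trans (sum-apply (mʳ (t e₁)) (mʳ-unitScaled e₁) (w (t e₂))) (w-sum e₂)) (w-sum e₁))
                               (+-identityʳ 0#))
        ; w-syndrome = w-syndrome₁₂
        }
        where
        g₁ g₂ : Aff r
        g₁ = g e₁
        g₂ = g e₂
        T-hom₁₂ : T (g₁ ∘A g₂) ≈A (T g₁ ∘A T g₂)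
        T-hom₁₂ = T-hom g₁ g₂ (g∈G e₁) (g∈G e₂)
        u-syndrome₁₂ : syndrome H (λ j → apply (mˡ (t e₁)) (u (t e₂)) j + u (t e₁) j) ≈v shift (g₁ ∘A g₂)
        u-syndrome₁₂ i = begin
          syndrome H (λ j → apply (mˡ (t e₁)) (u (t e₂)) j + u (t e₁) j) i
            ≡⟨ syndrome-+ H (apply (mˡ (t e₁)) (u (t e₂))) (u (t e₁)) i ⟩
          syndrome H (apply (mˡ (t e₁)) (u (t e₂))) i + syndrome H (u (t e₁)) i
            ≡⟨ cong₂ _+_ (trans (syndrome-apply (mˡ-represents e₁) (u (t e₂)) i) (·v-congʳ (lin g₁) (u-syndrome e₂) i))
                         (u-syndrome e₁ i) ⟩
          (lin g₁ ·v shift g₂) i + shift g₁ i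
            ≡⟨ +-comm _ _ ⟩
          shift (g₁ ∘A g₂) i ∎
        N₁ : Matrix r
        N₁ = lin (T g₁)
        w-syndrome₁₂ : syndrome (pos ι) (λ k → apply (mʳ (t e₁)) (w (t e₂)) k + w (t e₁) k) ≈v negv (shift (T (g₁ ∘A g₂)))
        w-syndrome₁₂ i = begin
          syndrome (pos ι) (λ k → apply (mʳ (t e₁)) (w (t e₂)) k + w (t e₁) k) i
            ≡⟨ syndrome-+ (pos ι) (apply (mʳ (t e₁)) (w (t e₂))) (w (t e₁)) i ⟩
          syndrome (pos ι) (apply (mʳ (t e₁)) (w (t e₂))) i + syndrome (pos ι) (w (t e₁)) i
            ≡⟨ cong₂ _+_ (trans (syndrome-apply (mʳ-represents e₁) (w (t e₂)) i)
                                (trans (·v-congʳ N₁ (w-syndrome e₂) i) (·v-negv N₁ _ i)))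
                         (w-syndrome e₁ i) ⟩
          - (N₁ ·v shift (T g₂)) i + - shift (T g₁) i
            ≡⟨ -‿+-comm _ _ ⟩
          - ((N₁ ·v shift (T g₂)) i + shift (T g₁) i)
            ≡⟨ cong -_ (+-comm _ _) ⟩
          - shift (T g₁ ∘A T g₂) i
            ≡⟨ cong -_ (sym (proj₁ T-hom₁₂ i)) ⟩
          - shift (T (g₁ ∘A g₂)) i ∎

      module Inverse (e : Element) where

        private
          g⁻¹-spec : ∃[ h ] (G h × (g e ∘A h) ≈A idA × (h ∘A g e) ≈A idA)
          g⁻¹-spec = proj₂ (proj₂ (proj₂ (proj₂ subgroup))) (g e) (g∈G e)

          g⁻¹ : Aff r
          g⁻¹ = proj₁ g⁻¹-spec

          g⁻¹∈G : G g⁻¹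
          g⁻¹∈G = proj₁ (proj₂ g⁻¹-spec)

          g∘g⁻¹≈id : (g e ∘A g⁻¹) ≈A idA
          g∘g⁻¹≈id = proj₁ (proj₂ (proj₂ g⁻¹-spec))

          g⁻¹∘g≈id : (g⁻¹ ∘A g e) ≈A idA
          g⁻¹∘g≈id = proj₂ (proj₂ (proj₂ g⁻¹-spec))

          Tg⁻¹∘Tg≈id : (T g⁻¹ ∘A T (g e)) ≈A idA
          Tg⁻¹∘Tg≈id = T-inverse g⁻¹ (g e) g⁻¹∈G (g∈G e) g⁻¹∘g≈id

          hamming-data : Σ[ m ∈ Monomial n ] Represents H (lin g⁻¹) m
          hamming-data = hamming-monomial hamming (G-GL g⁻¹ g⁻¹∈G)

          position-data : Σ[ m ∈ Monomial Q ] (Represents (pos ι) (lin (T g⁻¹)) m × UnitScaled m)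
          position-data = position-monomial ι (T-GL g⁻¹ g⁻¹∈G)

          mˡ′ : Monomial n
          mˡ′ = proj₁ hamming-data

          mʳ′ : Monomial Q
          mʳ′ = proj₁ position-data

          u-syndrome′ : syndrome H (λ j → - apply mˡ′ (u (t e)) j) ≈v shift g⁻¹
          u-syndrome′ i = begin
            syndrome H (λ j → - apply mˡ′ (u (t e)) j) i   ≡⟨ syndrome-neg H (apply mˡ′ (u (t e))) i ⟩
            - syndrome H (apply mˡ′ (u (t e))) i           ≡⟨ cong -_ (syndrome-apply (proj₂ hamming-data) (u (t e)) i) ⟩
            - (lin g⁻¹ ·v syndrome H (u (t e))) i          ≡⟨ cong -_ (·v-congʳ (lin g⁻¹) (u-syndrome e) i) ⟩
            - (lin g⁻¹ ·v shift (g e)) i                   ≡⟨ cong -_ (+-inverseʳ-unique _ _ (proj₁ g⁻¹∘g≈id i)) ⟩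
            - - shift g⁻¹ i                                ≡⟨ -‿involutive _ ⟩
            shift g⁻¹ i                                    ∎

          w-syndrome′ : syndrome (pos ι) (λ k → - apply mʳ′ (w (t e)) k) ≈v negv (shift (T g⁻¹))
          w-syndrome′ i = begin
            syndrome (pos ι) (λ k → - apply mʳ′ (w (t e)) k) i   ≡⟨ syndrome-neg (pos ι) (apply mʳ′ (w (t e))) i ⟩
            - syndrome (pos ι) (apply mʳ′ (w (t e))) i           ≡⟨ cong -_ (syndrome-apply (proj₁ (proj₂ position-data)) (w (t e)) i) ⟩
            - (N′ ·v syndrome (pos ι) (w (t e))) i               ≡⟨ cong -_ (trans (·v-congʳ N′ (w-syndrome e) i) (·v-negv N′ _ i)) ⟩
            - - (N′ ·v shift (T (g e))) i                        ≡⟨ -‿involutive _ ⟩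
            (N′ ·v shift (T (g e))) i                            ≡⟨ +-inverseʳ-unique _ _ (proj₁ Tg⁻¹∘Tg≈id i) ⟩
            - shift (T g⁻¹) i                                    ∎
            where
            N′ : Matrix r
            N′ = lin (T g⁻¹)

        element : Element
        element = record
          { g = g⁻¹ ; g∈G = g⁻¹∈G
          ; t = inverseₜ (t e) mˡ′ mʳ′
          ; mˡ-represents = proj₂ hamming-data
          ; mʳ-represents = proj₁ (proj₂ position-data)
          ; mʳ-unitScaled = proj₂ (proj₂ position-data)
          ; u-syndrome = u-syndrome′
          ; w-sum = trans (sum-neg (apply mʳ′ (w (t e))))
                          (trans (cong -_ (trans (sum-apply mʳ′ (proj₂ (proj₂ position-data)) (w (t e))) (w-sum e))) -0#≈0#)
          ; w-syndrome = w-syndrome′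
          }

        ⟦⟧-inverseˡ : ∀ z → ⟦ t element ⟧ (⟦ t e ⟧ z) ≈w z
        ⟦⟧-inverseˡ = ⟦⟧-inverseₜˡ (t e) mˡ′ mʳ′
          (hamming-∘ₘ-identity hamming (mˡ-represents e) (proj₂ hamming-data) (proj₂ g⁻¹∘g≈id))
          (position-∘ₘ-identity ι (mʳ-represents e) (proj₁ (proj₂ position-data))
                                  (mʳ-unitScaled e) (proj₂ (proj₂ position-data)) (proj₂ Tg⁻¹∘Tg≈id))

        ⟦⟧-inverseʳ : ∀ z → ⟦ t e ⟧ (⟦ t element ⟧ z) ≈w z
        ⟦⟧-inverseʳ = ⟦⟧-inverseₜʳ (t e) mˡ′ mʳ′
          (hamming-∘ₘ-identity hamming (proj₂ hamming-data) (mˡ-represents e) (proj₂ g∘g⁻¹≈id))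
          (position-∘ₘ-identity ι (proj₁ (proj₂ position-data)) (mʳ-represents e)
                                  (proj₂ (proj₂ position-data)) (mʳ-unitScaled e)
                                  (proj₂ (T-inverse (g e) g⁻¹ (g∈G e) g⁻¹∈G g∘g⁻¹≈id)))

      isometry : Element → Isometry (n ℕ.+ Q)
      isometry e = record
        { to = ⟦ t e ⟧ ; from = ⟦ t (Inverse.element e) ⟧
        ; to-from = Inverse.⟦⟧-inverseʳ e ; from-to = Inverse.⟦⟧-inverseˡ e
        ; isometric = dist-⟦⟧ (t e) }

      -- g is the element of G moving syndromeˡ x to syndromeˡ y; the translations u, w absorb the rest.
      transporter : ∀ {x y} → S H ι τ x → S H ι τ y → Σ[ e ∈ Element ] (⟦ t e ⟧ x ≈w y)
      transporter {x} {y} x∈S y∈S with proj₁ regular (syndromeˡ x) (syndromeˡ y)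
      ... | g₀ , g₀∈G , g₀a≈b = e₀ , λ i →
        trans (++-cong _ _ (λ j → x+[y-x]≡y _ (left y j)) (λ k → x+[y-x]≡y _ (right y k)) i) (sym (take++drop n y i))
        where
        a b : V r
        a = syndromeˡ x
        b = syndromeˡ y
        M N : Matrix r
        M = lin g₀
        N = lin (T g₀)
        hamming-data : Σ[ m ∈ Monomial n ] Represents H M m
        hamming-data = hamming-monomial hamming (G-GL g₀ g₀∈G)
        position-data : Σ[ m ∈ Monomial Q ] (Represents (pos ι) N m × UnitScaled m)
        position-data = position-monomial ι (T-GL g₀ g₀∈G)
        mˡ₀ : Monomial n
        mˡ₀ = proj₁ hamming-data
        mʳ₀ : Monomial Q
        mʳ₀ = proj₁ position-data
        u₀ : Word n
        u₀ j = left y j + - apply mˡ₀ (left x) j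
        w₀ : Word Q
        w₀ k = right y k + - apply mʳ₀ (right x) k
        u₀-syndrome : syndrome H u₀ ≈v shift g₀
        u₀-syndrome i = begin
          syndrome H u₀ i                                       ≡⟨ syndrome-+ H (left y) _ i ⟩
          b i + syndrome H (λ j → - apply mˡ₀ (left x) j) i     ≡⟨ cong (b i +_) (trans (syndrome-neg H _ i)
                                                                     (cong -_ (syndrome-apply (proj₂ hamming-data) (left x) i))) ⟩
          b i + - (M ·v a) i                                    ≡⟨ cong (λ s → s + - (M ·v a) i) (sym (g₀a≈b i)) ⟩
          (shift g₀ i + (M ·v a) i) + - (M ·v a) i              ≡⟨ //-rightDividesʳ _ _ ⟩
          shift g₀ i                                            ∎
        w₀-sum : sum w₀ ≡ 0#
        w₀-sum = begin
          sum w₀                                                ≡⟨ sum-distrib-+ (right y) _ ⟩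
          parity y + sum (λ k → - apply mʳ₀ (right x) k)        ≡⟨ cong₂ _+_ (proj₁ (S⇒checks y∈S)) (sum-neg (apply mʳ₀ (right x))) ⟩
          0# + - sum (apply mʳ₀ (right x))                      ≡⟨ cong (λ s → 0# + - s) (sum-apply mʳ₀ (proj₂ (proj₂ position-data)) (right x)) ⟩
          0# + - parity x                                       ≡⟨ cong (λ s → 0# + - s) (proj₁ (S⇒checks x∈S)) ⟩
          0# + - 0#                                             ≡⟨ -‿inverseʳ 0# ⟩
          0#                                                    ∎
        w₀-syndrome : syndrome (pos ι) w₀ ≈v negv (shift (T g₀))
        w₀-syndrome i = begin
          syndrome (pos ι) w₀ i
            ≡⟨ syndrome-+ (pos ι) (right y) _ i ⟩
          syndromeʳ y i + syndrome (pos ι) (λ k → - apply mʳ₀ (right x) k) i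
            ≡⟨ cong (syndromeʳ y i +_) (trans (syndrome-neg (pos ι) _ i)
                 (cong -_ (syndrome-apply (proj₁ (proj₂ position-data)) (right x) i))) ⟩
          syndromeʳ y i + - (N ·v syndromeʳ x) i
            ≡⟨ cong₂ (λ s v → s + - v) (proj₂ (S⇒checks y∈S) i)
                 (trans (·v-congʳ N (proj₂ (S⇒checks x∈S)) i) (·v-negv N _ i)) ⟩
          - τ b i + - - (N ·v τ a) i
            ≡⟨ cong₂ (λ s v → - s + v)
                 (trans (τ-cong b (act g₀ a) (λ i → sym (g₀a≈b i)) i)
                        (τ-equivariant subgroup regular automorphism induced g₀ g₀∈G a i))
                 (-‿involutive _) ⟩
          - (shift (T g₀) i + (N ·v τ a) i) + (N ·v τ a) i
            ≡⟨ cong (_+ (N ·v τ a) i) (sym (-‿+-comm _ _)) ⟩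
          (- shift (T g₀) i + - (N ·v τ a) i) + (N ·v τ a) i
            ≡⟨ //-rightDividesˡ _ _ ⟩
          - shift (T g₀) i ∎
        e₀ : Element
        e₀ = record
          { g = g₀ ; g∈G = g₀∈G
          ; t = transform mˡ₀ u₀ mʳ₀ w₀
          ; mˡ-represents = proj₂ hamming-data
          ; mʳ-represents = proj₁ (proj₂ position-data)
          ; mʳ-unitScaled = proj₂ (proj₂ position-data)
          ; u-syndrome = u₀-syndrome ; w-sum = w₀-sum ; w-syndrome = w₀-syndrome }

      ⟦⟧-determined : ∀ e₁ e₂ x → ⟦ t e₁ ⟧ x ≈w ⟦ t e₂ ⟧ x → ∀ z → ⟦ t e₁ ⟧ z ≈w ⟦ t e₂ ⟧ z
      ⟦⟧-determined e₁ e₂ x same =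
        ⟦⟧-cong-parts (t e₁) (t e₂) mˡ≈ u≈ mʳ≈ w≈
        where
        g₁≈g₂ : g e₁ ≈A g e₂
        g₁≈g₂ = proj₂ regular (g e₁) (g e₂) (syndromeˡ x) (g∈G e₁) (g∈G e₂) (λ i →
          trans (sym (syndromeˡ-⟦⟧ e₁ x i)) (trans (syndromeˡ-cong same i) (syndromeˡ-⟦⟧ e₂ x i)))
        Tg₁≈Tg₂ : T (g e₁) ≈A T (g e₂)
        Tg₁≈Tg₂ = proj₁ (proj₂ automorphism) (g e₁) (g e₂) (g∈G e₁) (g∈G e₂) g₁≈g₂
        mˡ≈ : ∀ x → apply (mˡ (t e₁)) x ≈w apply (mˡ (t e₂)) x
        mˡ≈ = hamming-represents-unique hamming (Represents-cong (proj₂ g₁≈g₂) (mˡ-represents e₁)) (mˡ-represents e₂)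
        mʳ≈ : ∀ y → apply (mʳ (t e₁)) y ≈w apply (mʳ (t e₂)) y
        mʳ≈ = position-represents-unique ι (Represents-cong (proj₂ Tg₁≈Tg₂) (mʳ-represents e₁)) (mʳ-represents e₂)
                                         (mʳ-unitScaled e₁) (mʳ-unitScaled e₂)
        u≈ : u (t e₁) ≈w u (t e₂)
        u≈ j = +-cancelˡ (apply (mˡ (t e₁)) (left x) j) _ _ (begin
          apply (mˡ (t e₁)) (left x) j + u (t e₁) j   ≡⟨ sym (left-⟦⟧ (t e₁) x j) ⟩
          left (⟦ t e₁ ⟧ x) j                         ≡⟨ same (j ↑ˡ Q) ⟩
          left (⟦ t e₂ ⟧ x) j                         ≡⟨ left-⟦⟧ (t e₂) x j ⟩
          apply (mˡ (t e₂)) (left x) j + u (t e₂) j   ≡⟨ cong (_+ u (t e₂) j) (sym (mˡ≈ (left x) j)) ⟩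
          apply (mˡ (t e₁)) (left x) j + u (t e₂) j   ∎)
        w≈ : w (t e₁) ≈w w (t e₂)
        w≈ k = +-cancelˡ (apply (mʳ (t e₁)) (right x) k) _ _ (begin
          apply (mʳ (t e₁)) (right x) k + w (t e₁) k  ≡⟨ sym (right-⟦⟧ (t e₁) x k) ⟩
          right (⟦ t e₁ ⟧ x) k                        ≡⟨ same (n ↑ʳ k) ⟩
          right (⟦ t e₂ ⟧ x) k                        ≡⟨ right-⟦⟧ (t e₂) x k ⟩
          apply (mʳ (t e₂)) (right x) k + w (t e₂) k  ≡⟨ cong (_+ w (t e₂) k) (sym (mʳ≈ (right x) k)) ⟩
          apply (mʳ (t e₁)) (right x) k + w (t e₂) k  ∎)

      InP : Isometry (n ℕ.+ Q) → Set
      InP φ = Σ[ e ∈ Element ] (∀ x → to φ x ≈w ⟦ t e ⟧ x)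

      from-InP : ∀ φ e → (∀ x → to φ x ≈w ⟦ t e ⟧ x) → ∀ y → from φ y ≈w ⟦ t (Inverse.element e) ⟧ y
      from-InP φ e φ≈e y i = begin
        from φ y i                                             ≡⟨ sym (Inverse.⟦⟧-inverseˡ e (from φ y) i) ⟩
        ⟦ t (Inverse.element e) ⟧ (⟦ t e ⟧ (from φ y)) i       ≡⟨ ⟦⟧-cong (t (Inverse.element e)) (λ i → sym (φ≈e (from φ y) i)) i ⟩
        ⟦ t (Inverse.element e) ⟧ (to φ (from φ y)) i          ≡⟨ ⟦⟧-cong (t (Inverse.element e)) (to-from φ y) i ⟩
        ⟦ t (Inverse.element e) ⟧ y i                          ∎

      propelinear : IsPropelinear (S H ι τ)
      propelinear = InP , InP-cong , InP⊆Aut , InP-id , InP-∘ , InP-inverse , InP-transitive , InP-free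
        where
        InP-cong : ∀ φ ψ → φ ≈I ψ → InP φ → InP ψ
        InP-cong φ ψ φ≈ψ (e , φ≈e) = e , λ x i → trans (sym (φ≈ψ x i)) (φ≈e x i)

        InP⊆Aut : ∀ φ → InP φ → InAut (S H ι τ) φ
        InP⊆Aut φ (e , φ≈e) =
          (λ x x∈S → S-cong (λ i → sym (φ≈e x i)) (⟦⟧-preserves-S e x∈S)) ,
          (λ y y∈S → S-cong (λ i → sym (from-InP φ e φ≈e y i)) (⟦⟧-preserves-S (Inverse.element e) y∈S))

        InP-id : InP idI
        InP-id = identity , λ x i → sym (⟦⟧-identity (t identity) apply-idₘ (λ _ → refl) apply-idₘ (λ _ → refl) x i)

        InP-∘ : ∀ φ ψ → InP φ → InP ψ → Σ[ χ ∈ Isometry (n ℕ.+ Q) ] (InP χ × (∀ x → to χ x ≈w to φ (to ψ x)))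
        InP-∘ φ ψ (e₁ , φ≈e₁) (e₂ , ψ≈e₂) = isometry (e₁ · e₂) , (e₁ · e₂ , λ _ _ → refl) , λ x i → begin
          ⟦ t e₁ ∘ₜ t e₂ ⟧ x i        ≡⟨ sym (⟦⟧-∘ₜ (t e₁) (t e₂) x i) ⟩
          ⟦ t e₁ ⟧ (⟦ t e₂ ⟧ x) i     ≡⟨ ⟦⟧-cong (t e₁) (λ i → sym (ψ≈e₂ x i)) i ⟩
          ⟦ t e₁ ⟧ (to ψ x) i         ≡⟨ sym (φ≈e₁ (to ψ x) i) ⟩
          to φ (to ψ x) i             ∎

        InP-inverse : ∀ φ → InP φ → Σ[ χ ∈ Isometry (n ℕ.+ Q) ] (InP χ × (∀ x → to χ x ≈w from φ x))
        InP-inverse φ (e , φ≈e) =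
          isometry (Inverse.element e) , (Inverse.element e , λ _ _ → refl) , λ x i → sym (from-InP φ e φ≈e x i)

        InP-transitive : ∀ x y → S H ι τ x → S H ι τ y → Σ[ φ ∈ Isometry (n ℕ.+ Q) ] (InP φ × to φ x ≈w y)
        InP-transitive x y x∈S y∈S = isometry (proj₁ moved) , (proj₁ moved , λ _ _ → refl) , proj₂ moved
          where
          moved : Σ[ e ∈ Element ] (⟦ t e ⟧ x ≈w y)
          moved = transporter x∈S y∈S

        InP-free : ∀ φ ψ x → S H ι τ x → InP φ → InP ψ → to φ x ≈w to ψ x → φ ≈I ψ
        InP-free φ ψ x _ (e₁ , φ≈e₁) (e₂ , ψ≈e₂) φx≈ψx z i =
          trans (φ≈e₁ z i) (trans (⟦⟧-determined e₁ e₂ x (λ i → trans (sym (φ≈e₁ x i)) (trans (φx≈ψx i) (ψ≈e₂ x i))) z i)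
                                  (sym (ψ≈e₂ z i)))

open import Data.Nat using (_+_; _*_)

suc^≡suc : ∀ q′ r → ∃[ Q′ ] (suc q′ ^ r ≡ suc Q′)
suc^≡suc q′ r with suc q′ ^ r in q^r≡
... | zero   = ⊥-elim (ℕ.1+n≢0 (ℕ.m^n≡0⇒m≡0 (suc q′) r q^r≡))
... | suc Q′ = Q′ , refl

extended-length : ∀ q r n → 1 ≤ q → n * (q ∸ 1) ≡ q ^ r ∸ 1 → (n + q ^ r) * (q ∸ 1) ≡ q ^ suc r ∸ 1
extended-length (suc q′) r n _ n[q-1]≡q^r-1 with suc^≡suc q′ r
... | Q′ , q^r≡ rewrite q^r≡ = begin
  (n + suc Q′) * q′       ≡⟨ ℕ.*-distribʳ-+ q′ n (suc Q′) ⟩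
  n * q′ + suc Q′ * q′    ≡⟨ cong (_+ suc Q′ * q′) n[q-1]≡q^r-1 ⟩
  Q′ + suc Q′ * q′        ≡⟨ cong (Q′ +_) (ℕ.*-comm (suc Q′) q′) ⟩
  Q′ + q′ * suc Q′        ∎
  where open ≡-Reasoning

theorem2 : ∀ {q : ℕ} (F : FiniteField q) → IsPrimePower q →
    let open Codes F in
    (r : ℕ) → 1 ≤ r →
    (n : ℕ) → n * (q ∸ 1) ≡ q ^ r ∸ 1 →
    (H : Fin n → V r) → IsHammingPCM H →
    (ι : Indexing r) →
    (G : Aff r → Set) → IsSubgroupGA G → IsRegular G →
    (T : Aff r → Aff r) → IsAutomorphism G T →
    (τ : V r → V r) → IsInducedPerm G T τ →
    IsPerfect (S H ι τ) × IsPropelinear (S H ι τ) × (n + q ^ r) * (q ∸ 1) ≡ q ^ suc r ∸ 1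
theorem2 {q} F _ (suc r) _ n n[q-1]≡q^r-1 H hamming ι G subgroup regular T automorphism τ induced =
  Perfect.perfect hamming (τ-injective F regular automorphism induced)
                          (τ-surjective F regular automorphism induced) j₀ ,
  Propelinear.propelinear hamming subgroup regular automorphism induced ,
  extended-length q (suc r) n q≥1 n[q-1]≡q^r-1
  where
  open FiniteField F
  open ExtendedCode F H ι τ (τ-cong F {T = T} regular induced)

  j₀ : Fin n
  j₀ = proj₁ (proj₂ (proj₂ hamming) (λ _ → 1#) (λ 1≈0 → 1≢0 F (1≈0 zero)))

  q≥1 : 1 ≤ q
  q≥1 = ℕ.≤-trans (ℕ.s≤s z≤n) (Fin.toℕ<n (Bundles.Inverse.to enumeration 0#))
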